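{- Let $n\geqslant 4$ and let $S$ be an independent set of the split-star $S_n^2$. (1) If $|S|=2$, then $|N(S)|\geqslant 4n-8$. (2) If $|S|=3$, then $|N(S)|\geqslant 6n-14$. (3) If $|S|=4$, then $|N(S)|\geqslant 8n-20$.
   Context: The split-star $S_n^2$ has as vertex set all permutations $p=p_1p_2\cdots p_n$ of $\{1,\ldots,n\}$. Let $p\,g_{12}$ be obtained from $p$ by swapping the symbols in positions $1$ and $2$; for $3\leqslant i\leqslant n$, let $p\,g_i^+$ be obtained from $p$ by first swapping the symbols in positions $2$ and $i$ and then swapping positions $1$ and $2$, and $p\,g_i^-$ be obtained by first swapping positions $1$ and $i$ and then swapping positions $1$ and $2$. Two vertices $p,q$ are adjacent iff $q=p\,g_{12}$ or $q\in\{p\,g_i^+,p\,g_i^-\}$ for some $i\in\{3,\ldots,n\}$. For a vertex set $S$, $N(S)$ denotes the set of vertices not in $S$ that are adjacent to at least one vertex of $S$. -}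

module Defs where

open import Data.Nat using (ℕ; _≤_)
open import Data.Fin using (Fin; toℕ)
open import Data.Fin.Permutation.Components using (transpose)
open import Data.Vec using (Vec; tabulate; lookup; toList)
open import Data.List using (List; length)
open import Data.List.Relation.Unary.All using (All)
open import Data.List.Relation.Unary.Unique.Propositional using (Unique)
open import Data.List.Membership.Propositional using (_∈_; _∉_)
open import Data.Product using (Σ; ∃; _×_)
open import Data.Sum using (_⊎_)
open import Relation.Binary.PropositionalEquality using (_≡_)
open import Relation.Nullary using (¬_)

-- A word p = p₁ p₂ ⋯ pₙ over {1,…,n}, encoded with symbols and positions in Fin n
-- (position k+1 of the paper is index k : Fin n).
Word : ℕ → Set
Word n = Vec (Fin n) n

-- p is a permutation: its n entries are pairwise distinct (hence all of Fin n occur).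
IsPerm : ∀ {n} → Word n → Set
IsPerm p = Unique (toList p)

swap : ∀ {n} → Fin n → Fin n → Word n → Word n
swap i j p = tabulate (λ k → lookup p (transpose i j k))

-- adjacency in the split-star S_n^2.
-- a, b are the (paper's) positions 1 and 2; i ranges over positions 3..n.
--   p g₁₂   = swap 1 2 p
--   p gᵢ⁺   = swap 1 2 (swap 2 i p)
--   p gᵢ⁻   = swap 1 2 (swap 1 i p)
Adj : ∀ {n} → Word n → Word n → Set
Adj {n} p q =
  Σ (Fin n) λ a → Σ (Fin n) λ b → toℕ a ≡ 0 × toℕ b ≡ 1 ×
    ( q ≡ swap a b p
    ⊎ Σ (Fin n) λ i → 2 ≤ toℕ i ×
        (q ≡ swap a b (swap b i p) ⊎ q ≡ swap a b (swap a i p)))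

IsIndependent : ∀ {n} → List (Word n) → Set
IsIndependent S = All IsPerm S × Unique S ×
  (∀ {p q} → p ∈ S → q ∈ S → ¬ Adj p q)

InN : ∀ {n} → List (Word n) → Word n → Set
InN S q = IsPerm q × q ∉ S × ∃ λ p → p ∈ S × Adj p q

AtLeast : ∀ {A : Set} → ℕ → (A → Set) → Set
AtLeast {A} k P = Σ (List A) λ L → Unique L × length L ≡ k × All P L

-- A vertex x of S²ₙ has the 2n − 3 neighbours x g, for g among g₁₂ and gᵢ^±, and two vertices x, y
-- determine the permutation π with y = x π. Writing permutations as words of transpositions, whether
-- two words agree depends only on which of their points coincide, so every local fact about S²ₙ used
-- here reduces to a statement about positions 1, 2 and at most six symbolic positions, decided by
-- running through their coincidence patterns. The facts are: two non-adjacent vertices share at most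
-- two neighbours, and two only when y = x (1 i), x (2 i) or x (1 i)(2 j), a shape that determines the
-- common neighbours; if x shares two neighbours with each of y and z, and y and z share one, then
-- x, y, z share one; and four vertices pairwise sharing two neighbours share none.
-- Inclusion–exclusion over the neighbourhoods of the vertices of S then bounds the number of repeated
-- neighbours by 2, 5 and 8, so |N(S)| ≥ 2(2n − 3) − 2, 3(2n − 3) − 5 and 4(2n − 3) − 8.
module Submission where

open import Defs
open import Data.Bool using (Bool; true; false; not; T; _∧_; _∨_; if_then_else_)
open import Data.Bool.Properties using (T-≡; T-∧; ∨-assoc)
open import Data.Empty using (⊥; ⊥-elim)
open import Data.Fin using (Fin; zero; suc; toℕ; fromℕ<; #_)
open import Data.Fin.Permutation.Components using (transpose; transpose-inverse)
open import Data.Fin.Properties using (_≟_; any?; all?; suc-injective; toℕ-injective; toℕ-fromℕ<)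
open import Data.List using (List; []; _∷_; length; _++_; map; concatMap; allFin; filterᵇ; take)
open import Data.List.Membership.Propositional using (_∈_; _∉_; find)
open import Data.List.Membership.Propositional.Properties
  using (∈-map⁺; ∈-map⁻; ∈-concatMap⁺; ∈-concatMap⁻; ∈-allFin; ∈-++⁺ˡ; ∈-++⁺ʳ; ∈-++⁻; ∈-filter⁻)
open import Data.List.Properties using (length-map; length-tabulate; length-++; length-removeAt′; length-take)
open import Data.List.Relation.Unary.All using (All; []; _∷_)
import Data.List.Relation.Unary.All as All
import Data.List.Relation.Unary.All.Properties as All
open import Data.List.Relation.Unary.Any using (Any; here; there; _─_)
import Data.List.Relation.Unary.Any as Any
open import Data.List.Relation.Unary.Any.Properties using (map⁺; map⁻)
open import Data.List.Relation.Unary.Unique.Propositional using (Unique; []; _∷_)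
import Data.List.Relation.Unary.Unique.Propositional.Properties as Unique
open import Data.Nat using (ℕ; zero; suc; _+_; _*_; _∸_; _≤_; _≤?_; z≤n; s≤s) renaming (_≟_ to _≟ℕ_)
open import Data.Nat.ListAction using (sum)
open import Data.Nat.Properties
  using (≤-reflexive; ≤-trans; ≤-pred; ≰⇒>; n≤1+n; m≤m+n; +-suc; *-suc; +-assoc; +-identityʳ; m+n∸n≡m; m≤n⇒m⊓n≡m;
         +-mono-≤; +-monoˡ-≤; +-monoʳ-≤; +-cancelʳ-≤; module ≤-Reasoning)
open import Data.Nat.Tactic.RingSolver using (solve-∀)
open import Data.Product using (∃; ∃₂; _×_; _,_; proj₁; proj₂)
import Data.Product
open import Data.Sum using (_⊎_; inj₁; inj₂; [_,_])
open import Data.Unit using (⊤)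
open import Data.Vec using (Vec; []; _∷_; lookup; tabulate; toList)
open import Data.Vec.Properties using (lookup∘tabulate; tabulate∘lookup; tabulate-cong; ≡-dec)
import Data.Vec.Relation.Unary.All as Vecᴬ
open import Data.Vec.Relation.Unary.All.Properties using (lookup⁺)
open import Function using (_∘_; id)
open import Function.Bundles using (Equivalence)
open import Relation.Binary.Definitions using (DecidableEquality)
open import Relation.Binary.PropositionalEquality
  using (_≡_; _≢_; refl; sym; trans; cong; cong₂; subst; subst₂; module ≡-Reasoning)
open import Relation.Nullary using (¬_; Dec; yes; no; does)
open import Relation.Nullary.Decidable using (isYes; T?; toWitness; fromWitness; map′; ¬?; _×-dec_; _⊎-dec_; _→-dec_)


transpose-matchˡ : ∀ {m} (i j k : Fin m) → k ≡ i → transpose i j k ≡ j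
transpose-matchˡ i j k k≡i with k ≟ i
... | yes _  = refl
... | no k≢i = ⊥-elim (k≢i k≡i)

transpose-matchʳ : ∀ {m} (i j k : Fin m) → k ≢ i → k ≡ j → transpose i j k ≡ i
transpose-matchʳ i j k k≢i k≡j with k ≟ i
... | yes k≡i = ⊥-elim (k≢i k≡i)
... | no _ with k ≟ j
...   | yes _  = refl
...   | no k≢j = ⊥-elim (k≢j k≡j)

transpose-mismatch : ∀ {m} (i j k : Fin m) → k ≢ i → k ≢ j → transpose i j k ≡ k
transpose-mismatch i j k k≢i k≢j with k ≟ i
... | yes k≡i = ⊥-elim (k≢i k≡i)
... | no _ with k ≟ j
...   | yes k≡j = ⊥-elim (k≢j k≡j)
...   | no _    = refl

transpose-same : ∀ {m} (i k : Fin m) → transpose i i k ≡ k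
transpose-same i k = by-cases (k ≟ i)
  where
  by-cases : Dec (k ≡ i) → transpose i i k ≡ k
  by-cases (yes k≡i) = trans (transpose-matchˡ i i k k≡i) (sym k≡i)
  by-cases (no k≢i)  = transpose-mismatch i i k k≢i k≢i

transpose-injective : ∀ {m} (i j : Fin m) {a b} → transpose i j a ≡ transpose i j b → a ≡ b
transpose-injective i j {a} {b} e =
  trans (sym (transpose-inverse j i)) (trans (cong (transpose j i) e) (transpose-inverse j i))

module _ {A : Set} where

  ∈-toList-lookup : ∀ {m} (v : Vec A m) j → lookup v j ∈ toList v
  ∈-toList-lookup (a ∷ v) zero    = here refl
  ∈-toList-lookup (a ∷ v) (suc j) = there (∈-toList-lookup v j)

  ∈-toList⇒lookup : ∀ {m} (v : Vec A m) {y} → y ∈ toList v → ∃ λ j → y ≡ lookup v j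
  ∈-toList⇒lookup (a ∷ v) (here e)  = zero , e
  ∈-toList⇒lookup (a ∷ v) (there m) with ∈-toList⇒lookup v m
  ... | j , e = suc j , e

  Unique⇒lookup-injective : ∀ {m} (v : Vec A m) → Unique (toList v) → ∀ {i j} → lookup v i ≡ lookup v j → i ≡ j
  Unique⇒lookup-injective (a ∷ v) u           {zero}  {zero}  e = refl
  Unique⇒lookup-injective (a ∷ v) (a∉ ∷ _)    {zero}  {suc j} e = ⊥-elim (All.lookup a∉ (∈-toList-lookup v j) e)
  Unique⇒lookup-injective (a ∷ v) (a∉ ∷ _)    {suc i} {zero}  e = ⊥-elim (All.lookup a∉ (∈-toList-lookup v i) (sym e))
  Unique⇒lookup-injective (a ∷ v) (_ ∷ u)     {suc i} {suc j} e = cong suc (Unique⇒lookup-injective v u e)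

  lookup-injective⇒Unique : ∀ {m} (v : Vec A m) → (∀ {i j} → lookup v i ≡ lookup v j → i ≡ j) → Unique (toList v)
  lookup-injective⇒Unique []      _   = []
  lookup-injective⇒Unique (a ∷ v) inj =
    All.tabulate (λ y∈ a≡y → a∉ (∈-toList⇒lookup v y∈) a≡y) ∷ lookup-injective⇒Unique v (suc-injective ∘ inj)
    where
    a∉ : ∀ {y} → (∃ λ j → y ≡ lookup v j) → a ≢ y
    a∉ (j , refl) a≡ with inj {zero} {suc j} a≡
    ... | ()

module _ {A B : Set} where

  Unique-map⁺ : ∀ (f : A → B) {xs} → (∀ {a b} → a ∈ xs → b ∈ xs → f a ≡ f b → a ≡ b) → Unique xs → Unique (map f xs)
  Unique-map⁺ f {[]}     _   []         = []
  Unique-map⁺ f {x ∷ xs} inj (x∉ ∷ u) =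
    All.tabulate (λ y∈ fx≡y → fx∉ (∈-map⁻ f y∈) fx≡y) ∷ Unique-map⁺ f (λ a∈ b∈ → inj (there a∈) (there b∈)) u
    where
    fx∉ : ∀ {y} → (∃ λ z → z ∈ xs × y ≡ f z) → f x ≢ y
    fx∉ (z , z∈ , refl) fx≡fz = All.lookup x∉ z∈ (inj (here refl) (there z∈) fx≡fz)

module _ {A : Set} where

  Unique-⊆⇒length-≤ : ∀ {xs ys : List A} → Unique xs → (∀ {x} → x ∈ xs → x ∈ ys) → length xs ≤ length ys
  Unique-⊆⇒length-≤ {[]}              _          _  = z≤n
  Unique-⊆⇒length-≤ {x ∷ xs} {ys} (x∉ ∷ u) xs⊆ys =
    subst (suc (length xs) ≤_) (sym (length-removeAt′ ys (Any.index x∈ys)))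
      (s≤s (Unique-⊆⇒length-≤ u λ {z} z∈xs → ∈-removeAt x∈ys (xs⊆ys (there z∈xs)) (λ { refl → All.lookup x∉ z∈xs refl })))
    where
    x∈ys : x ∈ ys
    x∈ys = xs⊆ys (here refl)
    ∈-removeAt : ∀ {x y ys} (x∈ys : x ∈ ys) → y ∈ ys → y ≢ x → y ∈ (ys ─ x∈ys)
    ∈-removeAt (here refl) (here refl) y≢x = ⊥-elim (y≢x refl)
    ∈-removeAt (here refl) (there y∈)  _   = y∈
    ∈-removeAt (there x∈)  (here refl) _   = here refl
    ∈-removeAt (there x∈)  (there y∈)  y≢x = there (∈-removeAt x∈ y∈ y≢x)

takeAtLeast : ∀ {A : Set} {P : A → Set} {xs : List A} k → Unique xs → All P xs → k ≤ length xs → AtLeast k P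
takeAtLeast {xs = xs} k u ps k≤ = take k xs , Unique.take⁺ k u , trans (length-take k xs) (m≤n⇒m⊓n≡m k≤) , All.take⁺ k ps

infixr 9 _∙_

data TExpr (X : Set) : Set where
  τ   : X → X → TExpr X
  _∙_ : TExpr X → TExpr X → TExpr X

mapᵀ : ∀ {X Y : Set} → (X → Y) → TExpr X → TExpr Y
mapᵀ f (τ a b) = τ (f a) (f b)
mapᵀ f (s ∙ t) = mapᵀ f s ∙ mapᵀ f t

⟦_⟧ : ∀ {m} → TExpr (Fin m) → Fin m → Fin m
⟦ τ a b ⟧ k = transpose a b k
⟦ s ∙ t ⟧ k = ⟦ s ⟧ (⟦ t ⟧ k)

infix 4 _≈ᵀ_ _≈ᵀ?_

_≈ᵀ_ : ∀ {m} → TExpr (Fin m) → TExpr (Fin m) → Set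
s ≈ᵀ t = ∀ k → ⟦ s ⟧ k ≡ ⟦ t ⟧ k

_≈ᵀ?_ : ∀ {m} (s t : TExpr (Fin m)) → Dec (s ≈ᵀ t)
s ≈ᵀ? t = all? (λ k → ⟦ s ⟧ k ≟ ⟦ t ⟧ k)

⟦⟧-injective : ∀ {m} (t : TExpr (Fin m)) {a b} → ⟦ t ⟧ a ≡ ⟦ t ⟧ b → a ≡ b
⟦⟧-injective (τ i j) e = transpose-injective i j e
⟦⟧-injective (s ∙ t) e = ⟦⟧-injective t (⟦⟧-injective s e)

SameKernel : ∀ {k} {A B : Set} → (Fin k → A) → (Fin k → B) → Set
SameKernel f g = ∀ u v → (f u ≡ f v → g u ≡ g v) × (g u ≡ g v → f u ≡ f v)

SameKernel-sym : ∀ {k} {A B : Set} {f : Fin k → A} {g : Fin k → B} → SameKernel f g → SameKernel g f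
SameKernel-sym fg u v = Data.Product.swap (fg u v)

⟦mapᵀ⟧-fixes : ∀ {k m} (g : Fin k → Fin m) (t : TExpr (Fin k)) {c} → (∀ u → g u ≢ c) → ⟦ mapᵀ g t ⟧ c ≡ c
⟦mapᵀ⟧-fixes g (τ a b) out = transpose-mismatch (g a) (g b) _ (λ e → out a (sym e)) (λ e → out b (sym e))
⟦mapᵀ⟧-fixes g (s ∙ t) out
  rewrite ⟦mapᵀ⟧-fixes g t out = ⟦mapᵀ⟧-fixes g s out

module _ {k m n} {f : Fin k → Fin m} {g : Fin k → Fin n} (fg : SameKernel f g) where

  ⟦mapᵀ⟧-track : ∀ t u → ∃ λ u′ → ⟦ mapᵀ f t ⟧ (f u) ≡ f u′ × ⟦ mapᵀ g t ⟧ (g u) ≡ g u′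
  ⟦mapᵀ⟧-track (τ a b) u = track-τ (f u ≟ f a) (f u ≟ f b)
    where
    track-τ : Dec (f u ≡ f a) → Dec (f u ≡ f b) →
      ∃ λ u′ → transpose (f a) (f b) (f u) ≡ f u′ × transpose (g a) (g b) (g u) ≡ g u′
    track-τ (yes ua) _ =
      b , transpose-matchˡ (f a) (f b) (f u) ua , transpose-matchˡ (g a) (g b) (g u) (proj₁ (fg u a) ua)
    track-τ (no ¬ua) (yes ub) =
      a , transpose-matchʳ (f a) (f b) (f u) ¬ua ub
        , transpose-matchʳ (g a) (g b) (g u) (λ e → ¬ua (proj₂ (fg u a) e)) (proj₁ (fg u b) ub)
    track-τ (no ¬ua) (no ¬ub) =
      u , transpose-mismatch (f a) (f b) (f u) ¬ua ¬ub
        , transpose-mismatch (g a) (g b) (g u) (λ e → ¬ua (proj₂ (fg u a) e)) (λ e → ¬ub (proj₂ (fg u b) e))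
  ⟦mapᵀ⟧-track (s ∙ t) u with ⟦mapᵀ⟧-track t u
  ... | u₁ , f₁ , g₁ with ⟦mapᵀ⟧-track s u₁
  ...   | u₂ , f₂ , g₂ = u₂ , trans (cong ⟦ mapᵀ f s ⟧ f₁) f₂ , trans (cong ⟦ mapᵀ g s ⟧ g₁) g₂

  -- Whether two expressions agree only depends on which of their points coincide.
  transfer : ∀ s t → mapᵀ f s ≈ᵀ mapᵀ f t → mapᵀ g s ≈ᵀ mapᵀ g t
  transfer s t s≈t c with any? (λ u → g u ≟ c)
  ... | no ∉img = trans (⟦mapᵀ⟧-fixes g s (λ u e → ∉img (u , e))) (sym (⟦mapᵀ⟧-fixes g t (λ u e → ∉img (u , e))))
  ... | yes (u , refl) with ⟦mapᵀ⟧-track s u | ⟦mapᵀ⟧-track t u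
  ...   | u₁ , f₁ , g₁ | u₂ , f₂ , g₂ =
    trans g₁ (trans (proj₁ (fg u₁ u₂) (trans (sym f₁) (trans (s≈t (f u)) f₂))) (sym g₂))

-- The equalities among the entries of a k-tuple: the head is new (zero) or
-- equal to entry j of the tail (suc j).
data Pattern : ℕ → Set where
  []  : Pattern zero
  _∷_ : ∀ {k} → Fin (suc k) → Pattern k → Pattern (suc k)

representative : ∀ {k} → Pattern k → Fin k → Fin k
representative (zero  ∷ p) zero    = zero
representative (suc j ∷ p) zero    = suc (representative p j)
representative (_     ∷ p) (suc a) = suc (representative p a)

patterns : (k : ℕ) → List (Pattern k)
patterns zero    = [] ∷ []
patterns (suc k) = concatMap (λ p → map (_∷ p) (allFin (suc k))) (patterns k)

∈-patterns : ∀ {k} (p : Pattern k) → p ∈ patterns k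
∈-patterns []          = Any.here refl
∈-patterns {suc k} (j ∷ p) =
  ∈-concatMap⁺ (λ p → map (_∷ p) (allFin (suc k)))
    (Any.map (λ { refl → ∈-map⁺ (_∷ p) (∈-allFin j) }) (∈-patterns p))

module _ {n : ℕ} where

  patternOf : ∀ {k} → Vec (Fin n) k → Pattern k
  patternOf []      = []
  patternOf (i ∷ v) with any? (λ j → lookup v j ≟ i)
  ... | yes (j , _) = suc j ∷ patternOf v
  ... | no _        = zero ∷ patternOf v

  lookup-representative : ∀ {k} (v : Vec (Fin n) k) a → lookup v (representative (patternOf v) a) ≡ lookup v a
  lookup-representative (i ∷ v) a with any? (λ j → lookup v j ≟ i)
  lookup-representative (i ∷ v) zero    | yes (j , vj≡i) = trans (lookup-representative v j) vj≡i
  lookup-representative (i ∷ v) zero    | no _           = refl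
  lookup-representative (i ∷ v) (suc a) | yes _          = lookup-representative v a
  lookup-representative (i ∷ v) (suc a) | no _           = lookup-representative v a

  representative-resp : ∀ {k} (v : Vec (Fin n) k) a b → lookup v a ≡ lookup v b →
    representative (patternOf v) a ≡ representative (patternOf v) b
  representative-resp (i ∷ v) a b e with any? (λ j → lookup v j ≟ i)
  representative-resp (i ∷ v) zero    zero    e | _              = refl
  representative-resp (i ∷ v) zero    (suc b) e | yes (j , vj≡i) = cong suc (representative-resp v j b (trans vj≡i e))
  representative-resp (i ∷ v) zero    (suc b) e | no ∄j          = ⊥-elim (∄j (b , sym e))
  representative-resp (i ∷ v) (suc a) zero    e | yes (j , vj≡i) = cong suc (representative-resp v a j (trans e (sym vj≡i)))
  representative-resp (i ∷ v) (suc a) zero    e | no ∄j          = ⊥-elim (∄j (a , e))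
  representative-resp (i ∷ v) (suc a) (suc b) e | yes _          = cong suc (representative-resp v a b e)
  representative-resp (i ∷ v) (suc a) (suc b) e | no _           = cong suc (representative-resp v a b e)

  patternOf-sameKernel : ∀ {k} (v : Vec (Fin n) k) → SameKernel (representative (patternOf v)) (lookup v)
  patternOf-sameKernel v a b =
    (λ e → trans (sym (lookup-representative v a)) (trans (cong (lookup v) e) (lookup-representative v b)))
    , representative-resp v a b

data Gen (X : Set) : Set where
  g₁₂     : Gen X
  g⁺ g⁻   : X → Gen X

g⁺-injective : ∀ {X : Set} {i j : X} → g⁺ i ≡ g⁺ j → i ≡ j
g⁺-injective refl = refl

g⁻-injective : ∀ {X : Set} {i j : X} → g⁻ i ≡ g⁻ j → i ≡ j
g⁻-injective refl = refl

mapᴳ : ∀ {X Y : Set} → (X → Y) → Gen X → Gen Y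
mapᴳ f g₁₂    = g₁₂
mapᴳ f (g⁺ i) = g⁺ (f i)
mapᴳ f (g⁻ i) = g⁻ (f i)

_⁻¹ : ∀ {X : Set} → Gen X → Gen X
g₁₂ ⁻¹    = g₁₂
(g⁺ i) ⁻¹ = g⁻ i
(g⁻ i) ⁻¹ = g⁺ i

mapᴳ-⁻¹ : ∀ {X Y : Set} (f : X → Y) g → mapᴳ f (g ⁻¹) ≡ mapᴳ f g ⁻¹
mapᴳ-⁻¹ f g₁₂    = refl
mapᴳ-⁻¹ f (g⁺ i) = refl
mapᴳ-⁻¹ f (g⁻ i) = refl

_≟ᴳ_ : ∀ {m} (g h : Gen (Fin m)) → Dec (g ≡ h)
g₁₂  ≟ᴳ g₁₂  = yes refl
g⁺ i ≟ᴳ g⁺ j with i ≟ j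
... | yes refl = yes refl
... | no i≢j   = no λ { refl → i≢j refl }
g⁻ i ≟ᴳ g⁻ j with i ≟ j
... | yes refl = yes refl
... | no i≢j   = no λ { refl → i≢j refl }
g₁₂  ≟ᴳ g⁺ _ = no λ ()
g₁₂  ≟ᴳ g⁻ _ = no λ ()
g⁺ _ ≟ᴳ g₁₂  = no λ ()
g⁺ _ ≟ᴳ g⁻ _ = no λ ()
g⁻ _ ≟ᴳ g₁₂  = no λ ()
g⁻ _ ≟ᴳ g⁺ _ = no λ ()

signed : ∀ {X : Set} → List X → List (Gen X)
signed []       = []
signed (i ∷ is) = g⁺ i ∷ g⁻ i ∷ signed is

-- The relative positions y = x (1 i), x (2 i), x (1 i)(2 j) of two vertices at distance two.
data Shape (X : Set) : Set where
  s₁ s₂ : X → Shape X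
  s₁₂   : X → X → Shape X

mapˢ : ∀ {X Y : Set} → (X → Y) → Shape X → Shape Y
mapˢ f (s₁ i)    = s₁ (f i)
mapˢ f (s₂ i)    = s₂ (f i)
mapˢ f (s₁₂ i j) = s₁₂ (f i) (f j)

Proper : ∀ {X : Set} → Shape X → Set
Proper (s₁ _)    = ⊤
Proper (s₂ _)    = ⊤
Proper (s₁₂ i j) = i ≢ j

Proper? : ∀ {m} (σ : Shape (Fin m)) → Dec (Proper σ)
Proper? (s₁ _)    = yes _
Proper? (s₂ _)    = yes _
Proper? (s₁₂ i j) = ¬? (i ≟ j)

-- The pairs (g , h) with x g = (x σ) h: the common neighbours of x and x σ.
commonPairs : ∀ {X : Set} → Shape X → List (Gen X × Gen X)
commonPairs (s₁ i)    = (g₁₂ , g⁻ i) ∷ (g⁻ i , g₁₂) ∷ []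
commonPairs (s₂ i)    = (g₁₂ , g⁺ i) ∷ (g⁺ i , g₁₂) ∷ []
commonPairs (s₁₂ i j) = (g⁻ i , g⁺ j) ∷ (g⁺ j , g⁻ i) ∷ []

module _ {k} {A B : Set} {f : Fin k → A} {g : Fin k → B} (fg : SameKernel f g) where

  mapᴳ-transfer : ∀ x y → mapᴳ f x ≡ mapᴳ f y → mapᴳ g x ≡ mapᴳ g y
  mapᴳ-transfer g₁₂    g₁₂    _    = refl
  mapᴳ-transfer (g⁺ i) (g⁺ j) e    = cong g⁺ (proj₁ (fg i j) (g⁺-injective e))
  mapᴳ-transfer (g⁻ i) (g⁻ j) e    = cong g⁻ (proj₁ (fg i j) (g⁻-injective e))
  mapᴳ-transfer g₁₂    (g⁺ _) ()
  mapᴳ-transfer g₁₂    (g⁻ _) ()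
  mapᴳ-transfer (g⁺ _) g₁₂    ()
  mapᴳ-transfer (g⁺ _) (g⁻ _) ()
  mapᴳ-transfer (g⁻ _) g₁₂    ()
  mapᴳ-transfer (g⁻ _) (g⁺ _) ()

  Proper-transfer : ∀ σ → Proper (mapˢ f σ) → Proper (mapˢ g σ)
  Proper-transfer (s₁ _)    _   = _
  Proper-transfer (s₂ _)    _   = _
  Proper-transfer (s₁₂ i j) i≢j = λ e → i≢j (proj₂ (fg i j) e)

p₁ p₂ : ∀ {m} → Fin (suc (suc m))
p₁ = zero
p₂ = suc zero

genExpr : ∀ {m} → Gen (Fin (suc (suc m))) → TExpr (Fin (suc (suc m)))
genExpr g₁₂    = τ p₁ p₂
genExpr (g⁺ i) = τ p₂ i ∙ τ p₁ p₂
genExpr (g⁻ i) = τ p₁ i ∙ τ p₁ p₂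

shapeExpr : ∀ {m} → Shape (Fin (suc (suc m))) → TExpr (Fin (suc (suc m)))
shapeExpr (s₁ i)    = τ p₁ i
shapeExpr (s₂ i)    = τ p₂ i
shapeExpr (s₁₂ i j) = τ p₁ i ∙ τ p₂ j

idᵀ : ∀ {m} → TExpr (Fin (suc (suc m)))
idᵀ = τ p₁ p₁

-- x g = y h, so y = x π with π = g h⁻¹.
quotientExpr : ∀ {m} → Gen (Fin (suc (suc m))) → Gen (Fin (suc (suc m))) → TExpr (Fin (suc (suc m)))
quotientExpr g h = genExpr g ∙ genExpr (h ⁻¹)

module _ {m m′} (f : Fin (suc (suc m)) → Fin (suc (suc m′))) (f₁ : f p₁ ≡ p₁) (f₂ : f p₂ ≡ p₂) where

  mapᵀ-genExpr : ∀ g → mapᵀ f (genExpr g) ≡ genExpr (mapᴳ f g)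
  mapᵀ-genExpr g₁₂    rewrite f₁ | f₂ = refl
  mapᵀ-genExpr (g⁺ i) rewrite f₁ | f₂ = refl
  mapᵀ-genExpr (g⁻ i) rewrite f₁ | f₂ = refl

  mapᵀ-shapeExpr : ∀ σ → mapᵀ f (shapeExpr σ) ≡ shapeExpr (mapˢ f σ)
  mapᵀ-shapeExpr (s₁ i)    rewrite f₁      = refl
  mapᵀ-shapeExpr (s₂ i)    rewrite f₂      = refl
  mapᵀ-shapeExpr (s₁₂ i j) rewrite f₁ | f₂ = refl

  mapᵀ-quotientExpr : ∀ g h → mapᵀ f (quotientExpr g h) ≡ quotientExpr (mapᴳ f g) (mapᴳ f h)
  mapᵀ-quotientExpr g h =
    cong₂ _∙_ (mapᵀ-genExpr g) (trans (mapᵀ-genExpr (h ⁻¹)) (cong genExpr (mapᴳ-⁻¹ f h)))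

-- The positions 3, …, n of the paper: those that generators g_i^± may use.
LegalPos : ∀ {m} → Fin m → Set
LegalPos i = 2 ≤ toℕ i

LegalGen : ∀ {m} → Gen (Fin m) → Set
LegalGen g₁₂    = ⊤
LegalGen (g⁺ i) = LegalPos i
LegalGen (g⁻ i) = LegalPos i

LegalShape : ∀ {m} → Shape (Fin m) → Set
LegalShape (s₁ i)    = LegalPos i
LegalShape (s₂ i)    = LegalPos i
LegalShape (s₁₂ i j) = LegalPos i × LegalPos j

commonPairs-legal : ∀ {m} (σ : Shape (Fin m)) → LegalShape σ → ∀ {g h} → (g , h) ∈ commonPairs σ → LegalGen g × LegalGen h
commonPairs-legal (s₁ i)    li        (here refl)         = _ , li
commonPairs-legal (s₁ i)    li        (there (here refl)) = li , _
commonPairs-legal (s₂ i)    li        (here refl)         = _ , li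
commonPairs-legal (s₂ i)    li        (there (here refl)) = li , _
commonPairs-legal (s₁₂ i j) (li , lj) (here refl)         = li , lj
commonPairs-legal (s₁₂ i j) (li , lj) (there (here refl)) = lj , li

length-commonPairs : ∀ {X : Set} (σ : Shape X) → length (commonPairs σ) ≡ 2
length-commonPairs (s₁ _)    = refl
length-commonPairs (s₂ _)    = refl
length-commonPairs (s₁₂ _ _) = refl

mapᴳ² : ∀ {X Y : Set} → (X → Y) → Gen X × Gen X → Gen Y × Gen Y
mapᴳ² f gh = mapᴳ f (proj₁ gh) , mapᴳ f (proj₂ gh)

commonPairs-map : ∀ {X Y : Set} (f : X → Y) σ → commonPairs (mapˢ f σ) ≡ map (mapᴳ² f) (commonPairs σ)
commonPairs-map f (s₁ _)    = refl
commonPairs-map f (s₂ _)    = refl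
commonPairs-map f (s₁₂ _ _) = refl

∈-commonPairs-map : ∀ {X Y : Set} (f : X → Y) σ {gh} → gh ∈ commonPairs σ → mapᴳ² f gh ∈ commonPairs (mapˢ f σ)
∈-commonPairs-map f σ gh∈ = subst (_ ∈_) (sym (commonPairs-map f σ)) (∈-map⁺ (mapᴳ² f) gh∈)

module _ {X : Set} where

  ∈-signed⁻ : ∀ {is : List X} {g} → g ∈ signed is → ∃ λ i → i ∈ is × (g ≡ g⁺ i ⊎ g ≡ g⁻ i)
  ∈-signed⁻ {i ∷ is} (here e)          = i , here refl , inj₁ e
  ∈-signed⁻ {i ∷ is} (there (here e))  = i , here refl , inj₂ e
  ∈-signed⁻ {i ∷ is} (there (there g∈)) with ∈-signed⁻ g∈
  ... | j , j∈ , e = j , there j∈ , e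

  ∈-signed⁺ : ∀ {is : List X} {i} → i ∈ is → g⁺ i ∈ signed is × g⁻ i ∈ signed is
  ∈-signed⁺ (here refl) = here refl , there (here refl)
  ∈-signed⁺ (there i∈)  = Data.Product.map (there ∘ there) (there ∘ there) (∈-signed⁺ i∈)

  Unique-signed : ∀ {is : List X} → Unique is → Unique (signed is)
  Unique-signed {[]}     []         = []
  Unique-signed {i ∷ is} (i∉ ∷ u) =
    ((λ ()) ∷ All.tabulate (λ g∈ → g⁺∉ (∈-signed⁻ g∈))) ∷ All.tabulate (λ g∈ → g⁻∉ (∈-signed⁻ g∈)) ∷ Unique-signed u
    where
    g⁺∉ : ∀ {g} → (∃ λ j → j ∈ is × (g ≡ g⁺ j ⊎ g ≡ g⁻ j)) → g⁺ i ≢ g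
    g⁺∉ (j , j∈ , inj₁ refl) refl = All.lookup i∉ j∈ refl
    g⁺∉ (j , j∈ , inj₂ refl) ()
    g⁻∉ : ∀ {g} → (∃ λ j → j ∈ is × (g ≡ g⁺ j ⊎ g ≡ g⁻ j)) → g⁻ i ≢ g
    g⁻∉ (j , j∈ , inj₁ refl) ()
    g⁻∉ (j , j∈ , inj₂ refl) refl = All.lookup i∉ j∈ refl

  length-signed : ∀ (is : List X) → length (signed is) ≡ 2 * length is
  length-signed []       = refl
  length-signed (i ∷ is) = trans (cong (λ l → suc (suc l)) (length-signed is)) (sym (*-suc 2 (length is)))

record Enumeration (A : Set) : Set where
  field
    elements : List A
    complete : ∀ x → x ∈ elements

∀? : ∀ {A : Set} {P : A → Set} → Enumeration A → (∀ x → Dec (P x)) → Dec (∀ x → P x)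
∀? e P? = map′ (λ all x → All.lookup all (complete x)) (λ all → All.tabulate (λ {x} _ → all x)) (All.all? P? elements)
  where open Enumeration e

patternsᴱ : ∀ k → Enumeration (Pattern k)
patternsᴱ k = record { elements = patterns k ; complete = ∈-patterns }

data GenKind : Set where
  k₁₂ k⁺ k⁻ : GenKind

gen : ∀ {X : Set} → GenKind → X → Gen X
gen k₁₂ _ = g₁₂
gen k⁺  i = g⁺ i
gen k⁻  i = g⁻ i

genKindsᴱ : Enumeration GenKind
genKindsᴱ = record { elements = k₁₂ ∷ k⁺ ∷ k⁻ ∷ [] ; complete = λ { k₁₂ → here refl ; k⁺ → there (here refl) ; k⁻ → there (there (here refl)) } }

_≟ᴷ_ : (s t : GenKind) → Dec (s ≡ t)
k₁₂ ≟ᴷ k₁₂ = yes refl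
k⁺  ≟ᴷ k⁺  = yes refl
k⁻  ≟ᴷ k⁻  = yes refl
k₁₂ ≟ᴷ k⁺  = no λ ()
k₁₂ ≟ᴷ k⁻  = no λ ()
k⁺  ≟ᴷ k₁₂ = no λ ()
k⁺  ≟ᴷ k⁻  = no λ ()
k⁻  ≟ᴷ k₁₂ = no λ ()
k⁻  ≟ᴷ k⁺  = no λ ()

kinds-pigeonhole : ∀ a b c d → a ≢ b → a ≢ c → a ≢ d → b ≢ c → b ≢ d → c ≢ d → ⊥
kinds-pigeonhole = toWitness {a? = ∀? genKindsᴱ λ a → ∀? genKindsᴱ λ b → ∀? genKindsᴱ λ c → ∀? genKindsᴱ λ d →
  ¬? (a ≟ᴷ b) →-dec ¬? (a ≟ᴷ c) →-dec ¬? (a ≟ᴷ d) →-dec ¬? (b ≟ᴷ c) →-dec ¬? (b ≟ᴷ d) →-dec ¬? (c ≟ᴷ d) →-dec no λ ()} _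

data ShapeKind : Set where
  k₁ k₂ k₁₂ : ShapeKind

shape : ∀ {X : Set} → ShapeKind → X → X → Shape X
shape k₁  i _ = s₁ i
shape k₂  i _ = s₂ i
shape k₁₂ i j = s₁₂ i j

shapeKindsᴱ : Enumeration ShapeKind
shapeKindsᴱ = record { elements = k₁ ∷ k₂ ∷ k₁₂ ∷ [] ; complete = λ { k₁ → here refl ; k₂ → there (here refl) ; k₁₂ → there (there (here refl)) } }

slot : ∀ {k} → Fin k → Fin (suc (suc k))
slot a = suc (suc a)

genTemplates : ∀ k → List (Gen (Fin (suc (suc k))))
genTemplates k = g₁₂ ∷ signed (map slot (allFin k))

shapeTemplates : ∀ k → List (Shape (Fin (suc (suc k))))
shapeTemplates k =
  map (s₁ ∘ slot) (allFin k) ++ map (s₂ ∘ slot) (allFin k) ++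
  concatMap (λ a → map (s₁₂ (slot a) ∘ slot) (allFin k)) (allFin k)

extend : ∀ {k m} → (Fin k → Fin (suc (suc m))) → Fin (suc (suc k)) → Fin (suc (suc m))
extend h zero          = zero
extend h (suc zero)    = suc zero
extend h (suc (suc a)) = h a

abstractInst : ∀ {k} → Pattern k → Fin (suc (suc k)) → Fin (suc (suc k))
abstractInst p = extend (slot ∘ representative p)

infix 4 _≈ᵀ⟨_⟩_ _≈ᵀ?⟨_⟩_ _≡ᴳ⟨_⟩_ _≟ᴳ⟨_⟩_

_≈ᵀ⟨_⟩_ : ∀ {k} → TExpr (Fin (suc (suc k))) → Pattern k → TExpr (Fin (suc (suc k))) → Set
s ≈ᵀ⟨ p ⟩ t = mapᵀ (abstractInst p) s ≈ᵀ mapᵀ (abstractInst p) t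

_≈ᵀ?⟨_⟩_ : ∀ {k} (s : TExpr (Fin (suc (suc k)))) p t → Dec (s ≈ᵀ⟨ p ⟩ t)
s ≈ᵀ?⟨ p ⟩ t = mapᵀ (abstractInst p) s ≈ᵀ? mapᵀ (abstractInst p) t

_≡ᴳ⟨_⟩_ : ∀ {k} → Gen (Fin (suc (suc k))) → Pattern k → Gen (Fin (suc (suc k))) → Set
g ≡ᴳ⟨ p ⟩ h = mapᴳ (abstractInst p) g ≡ mapᴳ (abstractInst p) h

_≟ᴳ⟨_⟩_ : ∀ {k} (g : Gen (Fin (suc (suc k)))) p h → Dec (g ≡ᴳ⟨ p ⟩ h)
g ≟ᴳ⟨ p ⟩ h = mapᴳ (abstractInst p) g ≟ᴳ mapᴳ (abstractInst p) h

ProperAt : ∀ {k} → Pattern k → Shape (Fin (suc (suc k))) → Set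
ProperAt p σ = Proper (mapˢ (abstractInst p) σ)

ProperAt? : ∀ {k} p (σ : Shape (Fin (suc (suc k)))) → Dec (ProperAt p σ)
ProperAt? p σ = Proper? (mapˢ (abstractInst p) σ)

-- Each check is a local lemma stated for templates whose slots are identified according to the
-- pattern p; it is decided by evaluation over all patterns and kinds.
InverseCheck : Pattern 1 → GenKind → Set
InverseCheck p t = quotientExpr g g ≈ᵀ⟨ p ⟩ idᵀ
  where g = gen t (slot (# 0))

inverse-check : ∀ p t → InverseCheck p t
inverse-check = toWitness {a? = ∀? (patternsᴱ 1) λ p → ∀? genKindsᴱ λ t → decide p t} _
  where
  decide : ∀ p t → Dec (InverseCheck p t)
  decide p t = quotientExpr g g ≈ᵀ?⟨ p ⟩ idᵀ
    where g = gen t (slot (# 0))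

GenInjectiveCheck : Pattern 2 → GenKind → GenKind → Set
GenInjectiveCheck p t u = genExpr g ≈ᵀ⟨ p ⟩ genExpr h → g ≡ᴳ⟨ p ⟩ h
  where g = gen t (slot (# 0)); h = gen u (slot (# 1))

genInjective-check : ∀ p t u → GenInjectiveCheck p t u
genInjective-check = toWitness {a? = ∀? (patternsᴱ 2) λ p → ∀? genKindsᴱ λ t → ∀? genKindsᴱ λ u → decide p t u} _
  where
  decide : ∀ p t u → Dec (GenInjectiveCheck p t u)
  decide p t u = genExpr g ≈ᵀ?⟨ p ⟩ genExpr h →-dec g ≟ᴳ⟨ p ⟩ h
    where g = gen t (slot (# 0)); h = gen u (slot (# 1))

ShapeCheck : Pattern 4 → GenKind → GenKind → GenKind → GenKind → Set
ShapeCheck p t₁ u₁ t₂ u₂ =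
  π ≈ᵀ⟨ p ⟩ quotientExpr g₂ h₂ → ¬ g₁ ≡ᴳ⟨ p ⟩ g₂ → ¬ π ≈ᵀ⟨ p ⟩ idᵀ →
  All (λ g → ¬ π ≈ᵀ⟨ p ⟩ genExpr g) (genTemplates 4) →
  Any (λ σ → ProperAt p σ × π ≈ᵀ⟨ p ⟩ shapeExpr σ) (shapeTemplates 4)
  where
  g₁ = gen t₁ (slot (# 0)); h₁ = gen u₁ (slot (# 1)); g₂ = gen t₂ (slot (# 2)); h₂ = gen u₂ (slot (# 3))
  π = quotientExpr g₁ h₁

shape-check : ∀ p t₁ u₁ t₂ u₂ → ShapeCheck p t₁ u₁ t₂ u₂
shape-check = toWitness {a? = ∀? (patternsᴱ 4) λ p → ∀? genKindsᴱ λ t₁ → ∀? genKindsᴱ λ u₁ →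
  ∀? genKindsᴱ λ t₂ → ∀? genKindsᴱ λ u₂ → decide p t₁ u₁ t₂ u₂} _
  where
  decide : ∀ p t₁ u₁ t₂ u₂ → Dec (ShapeCheck p t₁ u₁ t₂ u₂)
  decide p t₁ u₁ t₂ u₂ =
    π ≈ᵀ?⟨ p ⟩ quotientExpr g₂ h₂ →-dec ¬? (g₁ ≟ᴳ⟨ p ⟩ g₂) →-dec ¬? (π ≈ᵀ?⟨ p ⟩ idᵀ) →-dec
    All.all? (λ g → ¬? (π ≈ᵀ?⟨ p ⟩ genExpr g)) (genTemplates 4) →-dec
    Any.any? (λ σ → ProperAt? p σ ×-dec π ≈ᵀ?⟨ p ⟩ shapeExpr σ) (shapeTemplates 4)
    where
    g₁ = gen t₁ (slot (# 0)); h₁ = gen u₁ (slot (# 1)); g₂ = gen t₂ (slot (# 2)); h₂ = gen u₂ (slot (# 3))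
    π = quotientExpr g₁ h₁

CommonPairsCheck : Pattern 4 → GenKind → GenKind → ShapeKind → Set
CommonPairsCheck p t u r =
  ProperAt p σ → quotientExpr g h ≈ᵀ⟨ p ⟩ shapeExpr σ →
  Any (λ gh → g ≡ᴳ⟨ p ⟩ proj₁ gh × h ≡ᴳ⟨ p ⟩ proj₂ gh) (commonPairs σ)
  where g = gen t (slot (# 0)); h = gen u (slot (# 1)); σ = shape r (slot (# 2)) (slot (# 3))

commonPairs-check : ∀ p t u r → CommonPairsCheck p t u r
commonPairs-check = toWitness {a? = ∀? (patternsᴱ 4) λ p → ∀? genKindsᴱ λ t → ∀? genKindsᴱ λ u →
  ∀? shapeKindsᴱ λ r → decide p t u r} _
  where
  decide : ∀ p t u r → Dec (CommonPairsCheck p t u r)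
  decide p t u r =
    ProperAt? p σ →-dec quotientExpr g h ≈ᵀ?⟨ p ⟩ shapeExpr σ →-dec
    Any.any? (λ gh → g ≟ᴳ⟨ p ⟩ proj₁ gh ×-dec h ≟ᴳ⟨ p ⟩ proj₂ gh) (commonPairs σ)
    where g = gen t (slot (# 0)); h = gen u (slot (# 1)); σ = shape r (slot (# 2)) (slot (# 3))

CommonPairsSoundCheck : Pattern 2 → ShapeKind → Set
CommonPairsSoundCheck p r =
  ProperAt p σ → All (λ gh → genExpr (proj₁ gh) ≈ᵀ⟨ p ⟩ shapeExpr σ ∙ genExpr (proj₂ gh)) (commonPairs σ)
  where σ = shape r (slot (# 0)) (slot (# 1))

commonPairsSound-check : ∀ p r → CommonPairsSoundCheck p r
commonPairsSound-check = toWitness {a? = ∀? (patternsᴱ 2) λ p → ∀? shapeKindsᴱ λ r → decide p r} _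
  where
  decide : ∀ p r → Dec (CommonPairsSoundCheck p r)
  decide p r =
    ProperAt? p σ →-dec All.all? (λ gh → genExpr (proj₁ gh) ≈ᵀ?⟨ p ⟩ shapeExpr σ ∙ genExpr (proj₂ gh)) (commonPairs σ)
    where σ = shape r (slot (# 0)) (slot (# 1))

TriangleCheck : Pattern 6 → ShapeKind → ShapeKind → GenKind → GenKind → Set
TriangleCheck p r r′ t u =
  shapeExpr σ ∙ genExpr a ≈ᵀ⟨ p ⟩ shapeExpr σ′ ∙ genExpr b → ProperAt p σ → ProperAt p σ′ →
  ¬ shapeExpr σ ≈ᵀ⟨ p ⟩ shapeExpr σ′ →
  All (λ g → ¬ shapeExpr σ′ ≈ᵀ⟨ p ⟩ shapeExpr σ ∙ genExpr g) (genTemplates 6) →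
  Any (λ gh → Any (λ gh′ → proj₁ gh ≡ᴳ⟨ p ⟩ proj₁ gh′) (commonPairs σ′)) (commonPairs σ)
  where
  σ = shape r (slot (# 0)) (slot (# 1)); σ′ = shape r′ (slot (# 2)) (slot (# 3))
  a = gen t (slot (# 4)); b = gen u (slot (# 5))

triangle-check : ∀ p r r′ t u → TriangleCheck p r r′ t u
triangle-check = toWitness {a? = ∀? (patternsᴱ 6) λ p → ∀? shapeKindsᴱ λ r → ∀? shapeKindsᴱ λ r′ →
  ∀? genKindsᴱ λ t → ∀? genKindsᴱ λ u → decide p r r′ t u} _
  where
  -- Deciding the conclusion first settles most cases without evaluating the hypotheses.
  decide : ∀ p r r′ t u → Dec (TriangleCheck p r r′ t u)
  decide p r r′ t u with Any.any? (λ gh → Any.any? (λ gh′ → proj₁ gh ≟ᴳ⟨ p ⟩ proj₁ gh′) (commonPairs σ′)) (commonPairs σ)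
    where σ = shape r (slot (# 0)) (slot (# 1)); σ′ = shape r′ (slot (# 2)) (slot (# 3))
  ... | yes c = yes λ _ _ _ _ _ → c
  ... | no ¬c =
    shapeExpr σ ∙ genExpr a ≈ᵀ?⟨ p ⟩ shapeExpr σ′ ∙ genExpr b →-dec ProperAt? p σ →-dec ProperAt? p σ′ →-dec
    ¬? (shapeExpr σ ≈ᵀ?⟨ p ⟩ shapeExpr σ′) →-dec
    All.all? (λ g → ¬? (shapeExpr σ′ ≈ᵀ?⟨ p ⟩ shapeExpr σ ∙ genExpr g)) (genTemplates 6) →-dec
    no ¬c
    where
    σ = shape r (slot (# 0)) (slot (# 1)); σ′ = shape r′ (slot (# 2)) (slot (# 3))
    a = gen t (slot (# 4)); b = gen u (slot (# 5))

legal≢p₁ : ∀ {m} {i : Fin (suc (suc m))} → LegalPos i → i ≢ p₁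
legal≢p₁ {i = zero}  ()
legal≢p₁ {i = suc _} _ ()

legal≢p₂ : ∀ {m} {i : Fin (suc (suc m))} → LegalPos i → i ≢ p₂
legal≢p₂ {i = zero}        ()
legal≢p₂ {i = suc zero}    (s≤s ())
legal≢p₂ {i = suc (suc _)} _ ()

extend-sameKernel : ∀ {k m m′} {h : Fin k → Fin (suc (suc m))} {h′ : Fin k → Fin (suc (suc m′))} →
  SameKernel h h′ → (∀ a → LegalPos (h a)) → (∀ a → LegalPos (h′ a)) → SameKernel (extend h) (extend h′)
extend-sameKernel hh′ lh lh′ zero          zero          = (λ _ → refl) , (λ _ → refl)
extend-sameKernel hh′ lh lh′ (suc zero)    (suc zero)    = (λ _ → refl) , (λ _ → refl)
extend-sameKernel hh′ lh lh′ zero          (suc zero)    = (λ ()) , (λ ())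
extend-sameKernel hh′ lh lh′ (suc zero)    zero          = (λ ()) , (λ ())
extend-sameKernel hh′ lh lh′ zero          (suc (suc b)) = (λ e → ⊥-elim (legal≢p₁ (lh b) (sym e)))
                                                         , (λ e → ⊥-elim (legal≢p₁ (lh′ b) (sym e)))
extend-sameKernel hh′ lh lh′ (suc zero)    (suc (suc b)) = (λ e → ⊥-elim (legal≢p₂ (lh b) (sym e)))
                                                         , (λ e → ⊥-elim (legal≢p₂ (lh′ b) (sym e)))
extend-sameKernel hh′ lh lh′ (suc (suc a)) zero          = (λ e → ⊥-elim (legal≢p₁ (lh a) e))
                                                         , (λ e → ⊥-elim (legal≢p₁ (lh′ a) e))
extend-sameKernel hh′ lh lh′ (suc (suc a)) (suc zero)    = (λ e → ⊥-elim (legal≢p₂ (lh a) e))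
                                                         , (λ e → ⊥-elim (legal≢p₂ (lh′ a) e))
extend-sameKernel hh′ lh lh′ (suc (suc a)) (suc (suc b)) = hh′ a b

slot-legal : ∀ {k} (a : Fin k) → LegalPos (slot a)
slot-legal a = s≤s (s≤s z≤n)

mapᴳ-gen : ∀ {X Y : Set} (f : X → Y) t i → mapᴳ f (gen t i) ≡ gen t (f i)
mapᴳ-gen f k₁₂ i = refl
mapᴳ-gen f k⁺  i = refl
mapᴳ-gen f k⁻  i = refl

mapˢ-shape : ∀ {X Y : Set} (f : X → Y) r i j → mapˢ f (shape r i j) ≡ shape r (f i) (f j)
mapˢ-shape f k₁  i j = refl
mapˢ-shape f k₂  i j = refl
mapˢ-shape f k₁₂ i j = refl

module _ {n : ℕ} where

  -- Positions of S²ₙ₊₃: the offset guarantees a position 3 for every n.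
  Pos : Set
  Pos = Fin (suc (suc (suc n)))

  kind : Gen Pos → GenKind
  kind g₁₂    = k₁₂
  kind (g⁺ _) = k⁺
  kind (g⁻ _) = k⁻

  -- g₁₂ carries no index; position 3 stands in so that every index is legal.
  index : Gen Pos → Pos
  index g₁₂    = suc (suc zero)
  index (g⁺ i) = i
  index (g⁻ i) = i

  index-legal : ∀ g → LegalGen g → LegalPos (index g)
  index-legal g₁₂    _ = s≤s (s≤s z≤n)
  index-legal (g⁺ _) l = l
  index-legal (g⁻ _) l = l

  gen-kind-index : ∀ g → gen (kind g) (index g) ≡ g
  gen-kind-index g₁₂    = refl
  gen-kind-index (g⁺ _) = refl
  gen-kind-index (g⁻ _) = refl

  shapeKind : Shape Pos → ShapeKind
  shapeKind (s₁ _)    = k₁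
  shapeKind (s₂ _)    = k₂
  shapeKind (s₁₂ _ _) = k₁₂

  index₁ index₂ : Shape Pos → Pos
  index₁ (s₁ i)    = i
  index₁ (s₂ i)    = i
  index₁ (s₁₂ i _) = i
  index₂ (s₁₂ _ j) = j
  index₂ σ         = index₁ σ

  index₁-legal : ∀ σ → LegalShape σ → LegalPos (index₁ σ)
  index₁-legal (s₁ _)    l = l
  index₁-legal (s₂ _)    l = l
  index₁-legal (s₁₂ _ _) l = proj₁ l

  index₂-legal : ∀ σ → LegalShape σ → LegalPos (index₂ σ)
  index₂-legal (s₁ _)    l = l
  index₂-legal (s₂ _)    l = l
  index₂-legal (s₁₂ _ _) l = proj₂ l

  shape-kind-index : ∀ σ → shape (shapeKind σ) (index₁ σ) (index₂ σ) ≡ σ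
  shape-kind-index (s₁ _)    = refl
  shape-kind-index (s₂ _)    = refl
  shape-kind-index (s₁₂ _ _) = refl

genAt : ∀ {n k} → Gen (Fin (suc (suc (suc n)))) → Fin k → Gen (Fin (suc (suc k)))
genAt g a = gen (kind g) (slot a)

shapeAt : ∀ {n k} → Shape (Fin (suc (suc (suc n)))) → Fin k → Fin k → Shape (Fin (suc (suc k)))
shapeAt σ a b = shape (shapeKind σ) (slot a) (slot b)

-- The entries of v instantiate the slots of the templates; patternOf v records which of them coincide.
module Instance {n k} (v : Vec (Fin (suc (suc (suc n)))) k) (legal : Vecᴬ.All LegalPos v) where

  p : Pattern k
  p = patternOf v

  concrete : Fin (suc (suc k)) → Fin (suc (suc (suc n)))
  concrete = extend (lookup v)

  kernel : SameKernel (abstractInst p) concrete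
  kernel = extend-sameKernel slot-kernel (slot-legal ∘ representative p) (lookup⁺ legal)
    where
    slot-kernel : SameKernel (slot ∘ representative p) (lookup v)
    slot-kernel a b = (λ e → proj₁ (patternOf-sameKernel v a b) (suc-injective (suc-injective e)))
                    , (λ e → cong slot (proj₂ (patternOf-sameKernel v a b) e))

  toConcrete : ∀ s t → s ≈ᵀ⟨ p ⟩ t → mapᵀ concrete s ≈ᵀ mapᵀ concrete t
  toConcrete = transfer kernel

  toAbstract : ∀ s t → mapᵀ concrete s ≈ᵀ mapᵀ concrete t → s ≈ᵀ⟨ p ⟩ t
  toAbstract = transfer (SameKernel-sym kernel)

  genᶜ : ∀ g a → lookup v a ≡ index g → mapᴳ concrete (genAt g a) ≡ g
  genᶜ g a e = trans (mapᴳ-gen concrete (kind g) (slot a)) (trans (cong (gen (kind g)) e) (gen-kind-index g))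

  shapeᶜ : ∀ σ a b → lookup v a ≡ index₁ σ → lookup v b ≡ index₂ σ → mapˢ concrete (shapeAt σ a b) ≡ σ
  shapeᶜ σ a b e e′ =
    trans (mapˢ-shape concrete (shapeKind σ) (slot a) (slot b)) (trans (cong₂ (shape (shapeKind σ)) e e′) (shape-kind-index σ))

  genExprᶜ : ∀ g → mapᵀ concrete (genExpr g) ≡ genExpr (mapᴳ concrete g)
  genExprᶜ = mapᵀ-genExpr concrete refl refl

  shapeExprᶜ : ∀ σ → mapᵀ concrete (shapeExpr σ) ≡ shapeExpr (mapˢ concrete σ)
  shapeExprᶜ = mapᵀ-shapeExpr concrete refl refl

  genExprAt : ∀ g a → lookup v a ≡ index g → mapᵀ concrete (genExpr (genAt g a)) ≡ genExpr g
  genExprAt g a e = trans (genExprᶜ (genAt g a)) (cong genExpr (genᶜ g a e))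

  shapeExprAt : ∀ σ a b → lookup v a ≡ index₁ σ → lookup v b ≡ index₂ σ → mapᵀ concrete (shapeExpr (shapeAt σ a b)) ≡ shapeExpr σ
  shapeExprAt σ a b e e′ = trans (shapeExprᶜ (shapeAt σ a b)) (cong shapeExpr (shapeᶜ σ a b e e′))

  quotientExprAt : ∀ g h a b → lookup v a ≡ index g → lookup v b ≡ index h →
    mapᵀ concrete (quotientExpr (genAt g a) (genAt h b)) ≡ quotientExpr g h
  quotientExprAt g h a b e e′ =
    trans (mapᵀ-quotientExpr concrete refl refl (genAt g a) (genAt h b)) (cong₂ quotientExpr (genᶜ g a e) (genᶜ h b e′))

  properAt : ∀ σ a b → lookup v a ≡ index₁ σ → lookup v b ≡ index₂ σ → Proper σ → ProperAt p (shapeAt σ a b)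
  properAt σ a b e e′ proper =
    Proper-transfer (SameKernel-sym kernel) (shapeAt σ a b) (subst Proper (sym (shapeᶜ σ a b e e′)) proper)

  genTemplates-legal : ∀ {g} → g ∈ genTemplates k → LegalGen (mapᴳ concrete g)
  genTemplates-legal (here refl) = _
  genTemplates-legal (there g∈) with ∈-signed⁻ g∈
  ... | i , i∈ , g≡ with ∈-map⁻ slot i∈
  ...   | a , _ , refl with g≡
  ...     | inj₁ refl = lookup⁺ legal a
  ...     | inj₂ refl = lookup⁺ legal a

  shapeTemplates-legal : ∀ {σ} → σ ∈ shapeTemplates k → LegalShape (mapˢ concrete σ)
  shapeTemplates-legal σ∈ with ∈-++⁻ (map (s₁ ∘ slot) (allFin k)) σ∈
  ... | inj₁ σ∈₁ with ∈-map⁻ (s₁ ∘ slot) σ∈₁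
  ...   | a , _ , refl = lookup⁺ legal a
  shapeTemplates-legal σ∈ | inj₂ σ∈′ with ∈-++⁻ (map (s₂ ∘ slot) (allFin k)) σ∈′
  ...   | inj₁ σ∈₂ with ∈-map⁻ (s₂ ∘ slot) σ∈₂
  ...     | a , _ , refl = lookup⁺ legal a
  shapeTemplates-legal σ∈ | inj₂ σ∈′ | inj₂ σ∈₁₂
    with find (∈-concatMap⁻ (λ a → map (s₁₂ (slot a) ∘ slot) (allFin k)) {xs = allFin k} σ∈₁₂)
  ...     | a , _ , σ∈ₐ with ∈-map⁻ (s₁₂ (slot a) ∘ slot) σ∈ₐ
  ...       | b , _ , refl = lookup⁺ legal a , lookup⁺ legal b

module _ {n : ℕ} where

  quotientExpr-self : ∀ (g : Gen (Pos {n})) → LegalGen g → quotientExpr g g ≈ᵀ idᵀ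
  quotientExpr-self g lg =
    subst (_≈ᵀ idᵀ) (quotientExprAt g g (# 0) (# 0) refl refl) (toConcrete (quotientExpr (genAt g (# 0)) (genAt g (# 0))) idᵀ (inverse-check p (kind g)))
    where open Instance (index g ∷ []) (index-legal g lg Vecᴬ.∷ Vecᴬ.[])

  genExpr-injective : ∀ (g h : Gen (Pos {n})) → LegalGen g → LegalGen h → genExpr g ≈ᵀ genExpr h → g ≡ h
  genExpr-injective g h lg lh g≈h =
    subst₂ _≡_ (genᶜ g (# 0) refl) (genᶜ h (# 1) refl) (mapᴳ-transfer kernel gᵗ hᵗ
      (genInjective-check p (kind g) (kind h) (toAbstract (genExpr gᵗ) (genExpr hᵗ)
        (subst₂ _≈ᵀ_ (sym (genExprAt g (# 0) refl)) (sym (genExprAt h (# 1) refl)) g≈h))))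
    where
    open Instance (index g ∷ index h ∷ []) (index-legal g lg Vecᴬ.∷ index-legal h lh Vecᴬ.∷ Vecᴬ.[])
    gᵗ = genAt g (# 0)
    hᵗ = genAt h (# 1)

  distanceTwo-shape : ∀ (g₁ h₁ g₂ h₂ : Gen (Pos {n})) → LegalGen g₁ → LegalGen h₁ → LegalGen g₂ → LegalGen h₂ →
    quotientExpr g₁ h₁ ≈ᵀ quotientExpr g₂ h₂ → g₁ ≢ g₂ → ¬ quotientExpr g₁ h₁ ≈ᵀ idᵀ →
    (∀ g → LegalGen g → ¬ quotientExpr g₁ h₁ ≈ᵀ genExpr g) →
    ∃ λ σ → LegalShape σ × Proper σ × quotientExpr g₁ h₁ ≈ᵀ shapeExpr σ
  distanceTwo-shape g₁ h₁ g₂ h₂ lg₁ lh₁ lg₂ lh₂ π≈π₂ g₁≢g₂ π≉id π≉gen =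
    realise (find (shape-check p (kind g₁) (kind h₁) (kind g₂) (kind h₂) π≈π₂ᵃ g₁≢g₂ᵃ π≉idᵃ π≉genᵃ))
    where
    open Instance (index g₁ ∷ index h₁ ∷ index g₂ ∷ index h₂ ∷ [])
      (index-legal g₁ lg₁ Vecᴬ.∷ index-legal h₁ lh₁ Vecᴬ.∷ index-legal g₂ lg₂ Vecᴬ.∷ index-legal h₂ lh₂ Vecᴬ.∷ Vecᴬ.[])
    π  = quotientExpr (genAt g₁ (# 0)) (genAt h₁ (# 1))
    π₂ = quotientExpr (genAt g₂ (# 2)) (genAt h₂ (# 3))
    πᶜ : mapᵀ concrete π ≡ quotientExpr g₁ h₁
    πᶜ = quotientExprAt g₁ h₁ (# 0) (# 1) refl refl
    π≈π₂ᵃ : π ≈ᵀ⟨ p ⟩ π₂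
    π≈π₂ᵃ = toAbstract π π₂ (subst₂ _≈ᵀ_ (sym πᶜ) (sym (quotientExprAt g₂ h₂ (# 2) (# 3) refl refl)) π≈π₂)
    g₁≢g₂ᵃ : ¬ genAt g₁ (# 0) ≡ᴳ⟨ p ⟩ genAt g₂ (# 2)
    g₁≢g₂ᵃ e = g₁≢g₂ (subst₂ _≡_ (genᶜ g₁ (# 0) refl) (genᶜ g₂ (# 2) refl) (mapᴳ-transfer kernel _ _ e))
    π≉idᵃ : ¬ π ≈ᵀ⟨ p ⟩ idᵀ
    π≉idᵃ e = π≉id (subst (_≈ᵀ idᵀ) πᶜ (toConcrete π idᵀ e))
    π≉genᵃ : All (λ g → ¬ π ≈ᵀ⟨ p ⟩ genExpr g) (genTemplates 4)
    π≉genᵃ = All.tabulate λ {g} g∈ e →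
      π≉gen (mapᴳ concrete g) (genTemplates-legal g∈) (subst₂ _≈ᵀ_ πᶜ (genExprᶜ g) (toConcrete π (genExpr g) e))
    realise : (∃ λ σ → σ ∈ shapeTemplates 4 × ProperAt p σ × π ≈ᵀ⟨ p ⟩ shapeExpr σ) →
      ∃ λ σ → LegalShape σ × Proper σ × quotientExpr g₁ h₁ ≈ᵀ shapeExpr σ
    realise (σ , σ∈ , proper , π≈σ) =
      mapˢ concrete σ , shapeTemplates-legal σ∈ , Proper-transfer kernel σ proper
      , subst₂ _≈ᵀ_ πᶜ (shapeExprᶜ σ) (toConcrete π (shapeExpr σ) π≈σ)

  commonPairs-complete : ∀ (g h : Gen (Pos {n})) σ → LegalGen g → LegalGen h → LegalShape σ → Proper σ →
    quotientExpr g h ≈ᵀ shapeExpr σ → (g , h) ∈ commonPairs σ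
  commonPairs-complete g h σ lg lh lσ proper π≈σ =
    subst (λ τ → (g , h) ∈ commonPairs τ) (shapeᶜ σ (# 2) (# 3) refl refl)
      (subst ((g , h) ∈_) (sym (commonPairs-map concrete σᵗ))
        (map⁺ (Any.map realise (commonPairs-check p (kind g) (kind h) (shapeKind σ)
          (properAt σ (# 2) (# 3) refl refl proper) π≈σᵃ))))
    where
    open Instance (index g ∷ index h ∷ index₁ σ ∷ index₂ σ ∷ [])
      (index-legal g lg Vecᴬ.∷ index-legal h lh Vecᴬ.∷ index₁-legal σ lσ Vecᴬ.∷ index₂-legal σ lσ Vecᴬ.∷ Vecᴬ.[])
    gᵗ = genAt g (# 0)
    hᵗ = genAt h (# 1)
    σᵗ = shapeAt σ (# 2) (# 3)
    π≈σᵃ : quotientExpr gᵗ hᵗ ≈ᵀ⟨ p ⟩ shapeExpr σᵗ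
    π≈σᵃ = toAbstract (quotientExpr gᵗ hᵗ) (shapeExpr σᵗ)
      (subst₂ _≈ᵀ_ (sym (quotientExprAt g h (# 0) (# 1) refl refl)) (sym (shapeExprAt σ (# 2) (# 3) refl refl)) π≈σ)
    realise : ∀ {gh} → gᵗ ≡ᴳ⟨ p ⟩ proj₁ gh × hᵗ ≡ᴳ⟨ p ⟩ proj₂ gh → (g , h) ≡ mapᴳ² concrete gh
    realise {gh} (e₁ , e₂) = cong₂ _,_
      (trans (sym (genᶜ g (# 0) refl)) (mapᴳ-transfer kernel gᵗ (proj₁ gh) e₁))
      (trans (sym (genᶜ h (# 1) refl)) (mapᴳ-transfer kernel hᵗ (proj₂ gh) e₂))

  commonPairs-sound : ∀ (σ : Shape (Pos {n})) → LegalShape σ → Proper σ →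
    ∀ {g h} → (g , h) ∈ commonPairs σ → genExpr g ≈ᵀ shapeExpr σ ∙ genExpr h
  commonPairs-sound σ lσ proper {g} {h} gh∈ = sound (∈-map⁻ (mapᴳ² concrete) gh∈ᵗ)
    where
    open Instance (index₁ σ ∷ index₂ σ ∷ []) (index₁-legal σ lσ Vecᴬ.∷ index₂-legal σ lσ Vecᴬ.∷ Vecᴬ.[])
    σᵗ = shapeAt σ (# 0) (# 1)
    gh∈ᵗ : (g , h) ∈ map (mapᴳ² concrete) (commonPairs σᵗ)
    gh∈ᵗ = subst ((g , h) ∈_) (commonPairs-map concrete σᵗ)
      (subst (λ τ → (g , h) ∈ commonPairs τ) (sym (shapeᶜ σ (# 0) (# 1) refl refl)) gh∈)
    sound : (∃ λ gh → gh ∈ commonPairs σᵗ × (g , h) ≡ mapᴳ² concrete gh) → genExpr g ≈ᵀ shapeExpr σ ∙ genExpr h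
    sound ((gᵗ , hᵗ) , ghᵗ∈ , e) =
      subst₂ _≈ᵀ_ (trans (genExprᶜ gᵗ) (cong (genExpr ∘ proj₁) (sym e)))
        (cong₂ _∙_ (shapeExprAt σ (# 0) (# 1) refl refl) (trans (genExprᶜ hᵗ) (cong (genExpr ∘ proj₂) (sym e))))
        (toConcrete (genExpr gᵗ) (shapeExpr σᵗ ∙ genExpr hᵗ)
          (All.lookup (commonPairsSound-check p (shapeKind σ) (properAt σ (# 0) (# 1) refl refl proper)) ghᵗ∈))

  triangle : ∀ (σ σ′ : Shape (Pos {n})) a b → LegalShape σ → LegalShape σ′ → LegalGen a → LegalGen b →
    Proper σ → Proper σ′ → shapeExpr σ ∙ genExpr a ≈ᵀ shapeExpr σ′ ∙ genExpr b → ¬ shapeExpr σ ≈ᵀ shapeExpr σ′ →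
    (∀ g → LegalGen g → ¬ shapeExpr σ′ ≈ᵀ shapeExpr σ ∙ genExpr g) →
    ∃₂ λ gh gh′ → gh ∈ commonPairs σ × gh′ ∈ commonPairs σ′ × proj₁ gh ≡ proj₁ gh′
  triangle σ σ′ a b lσ lσ′ la lb proper proper′ σa≈σ′b σ≉σ′ σ′≉σg =
    realise (find (triangle-check p (shapeKind σ) (shapeKind σ′) (kind a) (kind b) σa≈σ′bᵃ
      (properAt σ (# 0) (# 1) refl refl proper) (properAt σ′ (# 2) (# 3) refl refl proper′) σ≉σ′ᵃ σ′≉σgᵃ))
    where
    open Instance (index₁ σ ∷ index₂ σ ∷ index₁ σ′ ∷ index₂ σ′ ∷ index a ∷ index b ∷ [])
      (index₁-legal σ lσ Vecᴬ.∷ index₂-legal σ lσ Vecᴬ.∷ index₁-legal σ′ lσ′ Vecᴬ.∷ index₂-legal σ′ lσ′ Vecᴬ.∷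
       index-legal a la Vecᴬ.∷ index-legal b lb Vecᴬ.∷ Vecᴬ.[])
    σᵗ  = shapeAt σ (# 0) (# 1)
    σ′ᵗ = shapeAt σ′ (# 2) (# 3)
    σᶜ : mapᵀ concrete (shapeExpr σᵗ) ≡ shapeExpr σ
    σᶜ = shapeExprAt σ (# 0) (# 1) refl refl
    σ′ᶜ : mapᵀ concrete (shapeExpr σ′ᵗ) ≡ shapeExpr σ′
    σ′ᶜ = shapeExprAt σ′ (# 2) (# 3) refl refl
    σa≈σ′bᵃ : shapeExpr σᵗ ∙ genExpr (genAt a (# 4)) ≈ᵀ⟨ p ⟩ shapeExpr σ′ᵗ ∙ genExpr (genAt b (# 5))
    σa≈σ′bᵃ = toAbstract (shapeExpr σᵗ ∙ genExpr (genAt a (# 4))) (shapeExpr σ′ᵗ ∙ genExpr (genAt b (# 5))) (subst₂ _≈ᵀ_ (sym (cong₂ _∙_ σᶜ (genExprAt a (# 4) refl)))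
      (sym (cong₂ _∙_ σ′ᶜ (genExprAt b (# 5) refl))) σa≈σ′b)
    σ≉σ′ᵃ : ¬ shapeExpr σᵗ ≈ᵀ⟨ p ⟩ shapeExpr σ′ᵗ
    σ≉σ′ᵃ e = σ≉σ′ (subst₂ _≈ᵀ_ σᶜ σ′ᶜ (toConcrete (shapeExpr σᵗ) (shapeExpr σ′ᵗ) e))
    σ′≉σgᵃ : All (λ g → ¬ shapeExpr σ′ᵗ ≈ᵀ⟨ p ⟩ shapeExpr σᵗ ∙ genExpr g) (genTemplates 6)
    σ′≉σgᵃ = All.tabulate λ {g} g∈ e → σ′≉σg (mapᴳ concrete g) (genTemplates-legal g∈)
      (subst₂ _≈ᵀ_ σ′ᶜ (cong₂ _∙_ σᶜ (genExprᶜ g)) (toConcrete (shapeExpr σ′ᵗ) (shapeExpr σᵗ ∙ genExpr g) e))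
    realise : (∃ λ gh → gh ∈ commonPairs σᵗ × Any (λ gh′ → proj₁ gh ≡ᴳ⟨ p ⟩ proj₁ gh′) (commonPairs σ′ᵗ)) →
      ∃₂ λ gh gh′ → gh ∈ commonPairs σ × gh′ ∈ commonPairs σ′ × proj₁ gh ≡ proj₁ gh′
    realise (gh , gh∈ , any′) with find any′
    ... | gh′ , gh′∈ , e =
      mapᴳ² concrete gh , mapᴳ² concrete gh′
      , subst (λ τ → mapᴳ² concrete gh ∈ commonPairs τ) (shapeᶜ σ (# 0) (# 1) refl refl) (∈-commonPairs-map concrete σᵗ gh∈)
      , subst (λ τ → mapᴳ² concrete gh′ ∈ commonPairs τ) (shapeᶜ σ′ (# 2) (# 3) refl refl) (∈-commonPairs-map concrete σ′ᵗ gh′∈)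
      , mapᴳ-transfer kernel (proj₁ gh) (proj₁ gh′) e

module _ {n : ℕ} where

  open ≡-Reasoning

  Vertex : Set
  Vertex = Word (suc (suc (suc n)))

  infixl 6 _·_

  -- Opaque, since unfolding x · t to its table defeats unification of x · s with x · t.
  opaque
    _·_ : Vertex → TExpr (Pos {n}) → Vertex
    x · t = tabulate (λ k → lookup x (⟦ t ⟧ k))

    lookup-· : ∀ x t k → lookup (x · t) k ≡ lookup x (⟦ t ⟧ k)
    lookup-· x t = lookup∘tabulate (λ k → lookup x (⟦ t ⟧ k))

  vertex-ext : ∀ {x y : Vertex} → (∀ k → lookup x k ≡ lookup y k) → x ≡ y
  vertex-ext {x} {y} h = trans (sym (tabulate∘lookup x)) (trans (tabulate-cong h) (tabulate∘lookup y))

  ·-∙ : ∀ x s t → x · (s ∙ t) ≡ x · s · t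
  ·-∙ x s t = vertex-ext λ k →
    trans (lookup-· x (s ∙ t) k) (trans (sym (lookup-· x s (⟦ t ⟧ k))) (sym (lookup-· (x · s) t k)))

  ·-resp-≈ᵀ : ∀ x {s t} → s ≈ᵀ t → x · s ≡ x · t
  ·-resp-≈ᵀ x {s} {t} s≈t = vertex-ext λ k → trans (lookup-· x s k) (trans (cong (lookup x) (s≈t k)) (sym (lookup-· x t k)))

  ·-idᵀ : ∀ x → x · idᵀ ≡ x
  ·-idᵀ x = vertex-ext λ k → trans (lookup-· x idᵀ k) (cong (lookup x) (transpose-same p₁ k))

  ·-cancelˡ : ∀ {x} → IsPerm x → ∀ s t → x · s ≡ x · t → s ≈ᵀ t
  ·-cancelˡ {x} px s t e k = Unique⇒lookup-injective x px
    (trans (sym (lookup-· x s k)) (trans (cong (λ z → lookup z k) e) (lookup-· x t k)))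

  IsPerm-· : ∀ {x} → IsPerm x → ∀ t → IsPerm (x · t)
  IsPerm-· {x} px t = lookup-injective⇒Unique (x · t) λ {i} {j} e →
    ⟦⟧-injective t (Unique⇒lookup-injective x px (trans (sym (lookup-· x t i)) (trans e (lookup-· x t j))))

  swap-· : ∀ a b (x : Vertex) → swap a b x ≡ x · τ a b
  swap-· a b x = vertex-ext λ k → trans (lookup∘tabulate (λ k → lookup x (transpose a b k)) k) (sym (lookup-· x (τ a b) k))

  swap-swap : ∀ a b c d (x : Vertex) → swap a b (swap c d x) ≡ x · τ c d ∙ τ a b
  swap-swap a b c d x = vertex-ext λ k → begin
    lookup (swap a b (swap c d x)) k           ≡⟨ lookup∘tabulate (λ k → lookup (swap c d x) (transpose a b k)) k ⟩
    lookup (swap c d x) (transpose a b k)      ≡⟨ lookup∘tabulate (λ k → lookup x (transpose c d k)) (transpose a b k) ⟩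
    lookup x (⟦ τ c d ∙ τ a b ⟧ k)             ≡⟨ sym (lookup-· x (τ c d ∙ τ a b) k) ⟩
    lookup (x · τ c d ∙ τ a b) k               ∎

  Adj⇒genExpr : ∀ {x y : Vertex} → Adj x y → ∃ λ g → LegalGen g × y ≡ x · genExpr g
  Adj⇒genExpr {x} (a , b , a≡0 , b≡1 , y≡)
    with toℕ-injective {i = a} {j = p₁} a≡0 | toℕ-injective {i = b} {j = p₂} b≡1
  ... | refl | refl with y≡
  ...   | inj₁ y≡xg₁₂                = g₁₂ , _ , trans y≡xg₁₂ (swap-· p₁ p₂ x)
  ...   | inj₂ (i , li , inj₁ y≡xg⁺) = g⁺ i , li , trans y≡xg⁺ (swap-swap p₁ p₂ p₂ i x)
  ...   | inj₂ (i , li , inj₂ y≡xg⁻) = g⁻ i , li , trans y≡xg⁻ (swap-swap p₁ p₂ p₁ i x)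

  genExpr⇒Adj : ∀ (x : Vertex) g → LegalGen g → Adj x (x · genExpr g)
  genExpr⇒Adj x g₁₂    _  = p₁ , p₂ , refl , refl , inj₁ (sym (swap-· p₁ p₂ x))
  genExpr⇒Adj x (g⁺ i) li = p₁ , p₂ , refl , refl , inj₂ (i , li , inj₁ (sym (swap-swap p₁ p₂ p₂ i x)))
  genExpr⇒Adj x (g⁻ i) li = p₁ , p₂ , refl , refl , inj₂ (i , li , inj₂ (sym (swap-swap p₁ p₂ p₁ i x)))

  legalGens : List (Gen (Pos {n}))
  legalGens = genTemplates (suc n)

  ∈-legalGens : ∀ g → LegalGen g → g ∈ legalGens
  ∈-legalGens g₁₂                _        = here refl
  ∈-legalGens (g⁺ (suc (suc i))) _        = there (proj₁ (∈-signed⁺ (∈-map⁺ slot (∈-allFin i))))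
  ∈-legalGens (g⁻ (suc (suc i))) _        = there (proj₂ (∈-signed⁺ (∈-map⁺ slot (∈-allFin i))))
  ∈-legalGens (g⁺ zero)          ()
  ∈-legalGens (g⁺ (suc zero))    (s≤s ())
  ∈-legalGens (g⁻ zero)          ()
  ∈-legalGens (g⁻ (suc zero))    (s≤s ())

  legalGens-legal : ∀ {g} → g ∈ legalGens → LegalGen g
  legalGens-legal (here refl) = _
  legalGens-legal (there g∈) with ∈-signed⁻ g∈
  ... | i , i∈ , g≡ with ∈-map⁻ slot i∈
  ...   | a , _ , refl with g≡
  ...     | inj₁ refl = slot-legal a
  ...     | inj₂ refl = slot-legal a

module _ {n : ℕ} where

  open ≡-Reasoning

  Unique-legalGens : Unique (legalGens {n})
  Unique-legalGens =
    All.tabulate (λ g∈ → g₁₂∉ (∈-signed⁻ g∈)) ∷ Unique-signed (Unique.map⁺ (suc-injective ∘ suc-injective) (Unique.allFin⁺ (suc n)))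
    where
    g₁₂∉ : ∀ {g : Gen (Pos {n})} → (∃ λ j → j ∈ map slot (allFin (suc n)) × (g ≡ g⁺ j ⊎ g ≡ g⁻ j)) → g₁₂ ≢ g
    g₁₂∉ (_ , _ , inj₁ refl) ()
    g₁₂∉ (_ , _ , inj₂ refl) ()

  length-legalGens : length (legalGens {n}) ≡ suc (2 * suc n)
  length-legalGens = cong suc (begin
    length (signed (map slot (allFin (suc n))))  ≡⟨ length-signed (map slot (allFin (suc n))) ⟩
    2 * length (map slot (allFin (suc n)))       ≡⟨ cong (2 *_) (length-map slot (allFin (suc n))) ⟩
    2 * length (allFin (suc n))                  ≡⟨ cong (2 *_) (length-tabulate {n = suc n} id) ⟩
    2 * suc n                                    ∎)

  -- Opaque, since elaborating counts over the unfolded neighbour lists is very slow.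
  opaque
    neighbours : Vertex {n} → List (Vertex {n})
    neighbours x = map (λ g → x · genExpr g) legalGens

    ∈-neighbours⁻ : ∀ {x r : Vertex {n}} → r ∈ neighbours x → ∃ λ g → LegalGen g × r ≡ x · genExpr g
    ∈-neighbours⁻ {x} r∈ with ∈-map⁻ (λ g → x · genExpr g) r∈
    ... | g , g∈ , r≡ = g , legalGens-legal g∈ , r≡

    ∈-neighbours⁺ : ∀ (x : Vertex {n}) g → LegalGen g → x · genExpr g ∈ neighbours x
    ∈-neighbours⁺ x g lg = ∈-map⁺ (λ g → x · genExpr g) (∈-legalGens g lg)

    Unique-neighbours : ∀ {x : Vertex {n}} → IsPerm x → Unique (neighbours x)
    Unique-neighbours {x} px = Unique-map⁺ (λ g → x · genExpr g)
      (λ {g} {h} g∈ h∈ e → genExpr-injective g h (legalGens-legal g∈) (legalGens-legal h∈) (·-cancelˡ px (genExpr g) (genExpr h) e)) Unique-legalGens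

    length-neighbours : ∀ (x : Vertex {n}) → length (neighbours x) ≡ suc (2 * suc n)
    length-neighbours x = trans (length-map (λ g → x · genExpr g) legalGens) length-legalGens

  ∈neighbours⇒Adj : ∀ {x y : Vertex {n}} → y ∈ neighbours x → Adj x y
  ∈neighbours⇒Adj {x} y∈ with ∈-neighbours⁻ {x = x} y∈
  ... | g , lg , y≡ = subst (Adj x) (sym y≡) (genExpr⇒Adj x g lg)

commonPairs-kinds : ∀ {n} (σ : Shape (Pos {n})) {g h} → (g , h) ∈ commonPairs σ → kind g ≢ kind h
commonPairs-kinds (s₁ _)    (here refl)         ()
commonPairs-kinds (s₁ _)    (there (here refl)) ()
commonPairs-kinds (s₂ _)    (here refl)         ()
commonPairs-kinds (s₂ _)    (there (here refl)) ()
commonPairs-kinds (s₁₂ _ _) (here refl)         ()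
commonPairs-kinds (s₁₂ _ _) (there (here refl)) ()

module _ {n : ℕ} where

  open ≡-Reasoning

  Common : Vertex {n} → Vertex {n} → Vertex {n} → Set
  Common x y r = r ∈ neighbours x × r ∈ neighbours y

  DistanceTwo : Vertex {n} → Vertex {n} → Set
  DistanceTwo x y = ∃ λ σ → LegalShape σ × Proper σ × y ≡ x · shapeExpr σ

  common⇒quotient : ∀ {x y : Vertex {n}} g h → LegalGen h → x · genExpr g ≡ y · genExpr h → y ≡ x · quotientExpr g h
  common⇒quotient {x} {y} g h lh xg≡yh = begin
    y                              ≡⟨ sym (·-idᵀ y) ⟩
    y · idᵀ                        ≡⟨ ·-resp-≈ᵀ y (λ k → sym (quotientExpr-self h lh k)) ⟩
    y · quotientExpr h h           ≡⟨ ·-∙ y (genExpr h) (genExpr (h ⁻¹)) ⟩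
    y · genExpr h · genExpr (h ⁻¹) ≡⟨ cong (_· genExpr (h ⁻¹)) (sym xg≡yh) ⟩
    x · genExpr g · genExpr (h ⁻¹) ≡⟨ sym (·-∙ x (genExpr g) (genExpr (h ⁻¹))) ⟩
    x · quotientExpr g h           ∎

  twoCommon⇒DistanceTwo : ∀ {x y r₁ r₂ : Vertex {n}} → IsPerm x → x ≢ y → ¬ Adj x y →
    Common x y r₁ → Common x y r₂ → r₁ ≢ r₂ → DistanceTwo x y
  twoCommon⇒DistanceTwo {x} {y} px x≢y ¬xy (r₁∈x , r₁∈y) (r₂∈x , r₂∈y) r₁≢r₂
    with ∈-neighbours⁻ {x = x} r₁∈x | ∈-neighbours⁻ {x = y} r₁∈y | ∈-neighbours⁻ {x = x} r₂∈x | ∈-neighbours⁻ {x = y} r₂∈y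
  ... | g₁ , lg₁ , r₁≡xg₁ | h₁ , lh₁ , r₁≡yh₁ | g₂ , lg₂ , r₂≡xg₂ | h₂ , lh₂ , r₂≡yh₂ = realise
    (distanceTwo-shape g₁ h₁ g₂ h₂ lg₁ lh₁ lg₂ lh₂ π₁≈π₂ g₁≢g₂ π₁≉id π₁≉gen)
    where
    π₁ = quotientExpr g₁ h₁
    y≡xπ₁ : y ≡ x · π₁
    y≡xπ₁ = common⇒quotient g₁ h₁ lh₁ (trans (sym r₁≡xg₁) r₁≡yh₁)
    y≡xπ₂ : y ≡ x · quotientExpr g₂ h₂
    y≡xπ₂ = common⇒quotient g₂ h₂ lh₂ (trans (sym r₂≡xg₂) r₂≡yh₂)
    π₁≈π₂ : π₁ ≈ᵀ quotientExpr g₂ h₂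
    π₁≈π₂ = ·-cancelˡ px π₁ (quotientExpr g₂ h₂) (trans (sym y≡xπ₁) y≡xπ₂)
    g₁≢g₂ : g₁ ≢ g₂
    g₁≢g₂ refl = r₁≢r₂ (trans r₁≡xg₁ (sym r₂≡xg₂))
    π₁≉id : ¬ π₁ ≈ᵀ idᵀ
    π₁≉id π₁≈id = x≢y (sym (trans y≡xπ₁ (trans (·-resp-≈ᵀ x π₁≈id) (·-idᵀ x))))
    π₁≉gen : ∀ g → LegalGen g → ¬ π₁ ≈ᵀ genExpr g
    π₁≉gen g lg π₁≈g = ¬xy (subst (Adj x) (sym (trans y≡xπ₁ (·-resp-≈ᵀ x π₁≈g))) (genExpr⇒Adj x g lg))
    realise : (∃ λ σ → LegalShape σ × Proper σ × π₁ ≈ᵀ shapeExpr σ) → DistanceTwo x y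
    realise (σ , lσ , proper , π₁≈σ) = σ , lσ , proper , trans y≡xπ₁ (·-resp-≈ᵀ x π₁≈σ)

  common-commonPairs : ∀ {x y : Vertex {n}} → IsPerm x → ((σ , _) : DistanceTwo x y) →
    ∀ {g h} → LegalGen g → LegalGen h → x · genExpr g ≡ y · genExpr h → (g , h) ∈ commonPairs σ
  common-commonPairs {x} px (σ , lσ , proper , y≡xσ) {g} {h} lg lh xg≡yh = commonPairs-complete g h σ lg lh lσ proper
    (·-cancelˡ px (quotientExpr g h) (shapeExpr σ) (trans (sym (common⇒quotient g h lh xg≡yh)) y≡xσ))

  commonPairs⇒common : ∀ {x y : Vertex {n}} ((σ , _) : DistanceTwo x y) →
    ∀ {g h} → (g , h) ∈ commonPairs σ → Common x y (x · genExpr g)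
  commonPairs⇒common {x} {y} (σ , lσ , proper , y≡xσ) {g} {h} gh∈ with commonPairs-legal σ lσ gh∈
  ... | lg , lh = ∈-neighbours⁺ x g lg , subst (_∈ neighbours y) (sym xg≡yh) (∈-neighbours⁺ y h lh)
    where
    xg≡yh : x · genExpr g ≡ y · genExpr h
    xg≡yh = begin
      x · genExpr g                  ≡⟨ ·-resp-≈ᵀ x (commonPairs-sound σ lσ proper gh∈) ⟩
      x · shapeExpr σ ∙ genExpr h    ≡⟨ ·-∙ x (shapeExpr σ) (genExpr h) ⟩
      x · shapeExpr σ · genExpr h    ≡⟨ cong (_· genExpr h) (sym y≡xσ) ⟩
      y · genExpr h                  ∎

  DistanceTwo⇒kinds : ∀ {x y : Vertex {n}} → IsPerm x → DistanceTwo x y →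
    ∀ {g h} → LegalGen g → LegalGen h → x · genExpr g ≡ y · genExpr h → kind g ≢ kind h
  DistanceTwo⇒kinds px d@(σ , _) lg lh xg≡yh = commonPairs-kinds σ (common-commonPairs px d lg lh xg≡yh)

  triangle-common : ∀ {x y z r : Vertex {n}} → IsPerm x → y ≢ z → ¬ Adj y z → DistanceTwo x y → DistanceTwo x z →
    Common y z r → ∃ λ r′ → Common x y r′ × r′ ∈ neighbours z
  triangle-common {x} {y} {z} px y≢z ¬yz dy@(σ , lσ , proper , y≡xσ) dz@(σ′ , lσ′ , proper′ , z≡xσ′) (r∈y , r∈z)
    with ∈-neighbours⁻ {x = y} r∈y | ∈-neighbours⁻ {x = z} r∈z
  ... | a , la , r≡ya | b , lb , r≡zb = realise
    (triangle σ σ′ a b lσ lσ′ la lb proper proper′ σa≈σ′b σ≉σ′ σ′≉σg)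
    where
    σa≈σ′b : shapeExpr σ ∙ genExpr a ≈ᵀ shapeExpr σ′ ∙ genExpr b
    σa≈σ′b = ·-cancelˡ px _ _ (begin
      x · shapeExpr σ ∙ genExpr a    ≡⟨ ·-∙ x (shapeExpr σ) (genExpr a) ⟩
      x · shapeExpr σ · genExpr a    ≡⟨ cong (_· genExpr a) (sym y≡xσ) ⟩
      y · genExpr a                  ≡⟨ trans (sym r≡ya) r≡zb ⟩
      z · genExpr b                  ≡⟨ cong (_· genExpr b) z≡xσ′ ⟩
      x · shapeExpr σ′ · genExpr b   ≡⟨ sym (·-∙ x (shapeExpr σ′) (genExpr b)) ⟩
      x · shapeExpr σ′ ∙ genExpr b   ∎)
    σ≉σ′ : ¬ shapeExpr σ ≈ᵀ shapeExpr σ′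
    σ≉σ′ σ≈σ′ = y≢z (trans y≡xσ (trans (·-resp-≈ᵀ x σ≈σ′) (sym z≡xσ′)))
    σ′≉σg : ∀ g → LegalGen g → ¬ shapeExpr σ′ ≈ᵀ shapeExpr σ ∙ genExpr g
    σ′≉σg g lg σ′≈σg = ¬yz (subst (Adj y) (sym z≡yg) (genExpr⇒Adj y g lg))
      where
      z≡yg : z ≡ y · genExpr g
      z≡yg = begin
        z                            ≡⟨ z≡xσ′ ⟩
        x · shapeExpr σ′             ≡⟨ ·-resp-≈ᵀ x σ′≈σg ⟩
        x · shapeExpr σ ∙ genExpr g  ≡⟨ ·-∙ x (shapeExpr σ) (genExpr g) ⟩
        x · shapeExpr σ · genExpr g  ≡⟨ cong (_· genExpr g) (sym y≡xσ) ⟩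
        y · genExpr g                ∎
    realise : (∃₂ λ gh gh′ → gh ∈ commonPairs σ × gh′ ∈ commonPairs σ′ × proj₁ gh ≡ proj₁ gh′) →
      ∃ λ r′ → Common x y r′ × r′ ∈ neighbours z
    realise (gh , gh′ , gh∈ , gh′∈ , g≡g′) =
      x · genExpr (proj₁ gh) , commonPairs⇒common dy gh∈
      , subst (λ g → x · genExpr g ∈ neighbours z) (sym g≡g′) (proj₂ (commonPairs⇒common dz gh′∈))

indicator : Bool → ℕ
indicator b = if b then 1 else 0

module Counting {A : Set} (_≟_ : DecidableEquality A) where

  open import Data.List.Membership.DecPropositional _≟_ using (_∈?_)

  infix 8 _∈ᵇ_

  _∈ᵇ_ : A → List A → Bool
  x ∈ᵇ xs = isYes (x ∈? xs)

  ∈ᵇ⇒∈ : ∀ {x xs} → T (x ∈ᵇ xs) → x ∈ xs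
  ∈ᵇ⇒∈ {x} {xs} = toWitness {a? = x ∈? xs}

  ∈⇒∈ᵇ : ∀ {x xs} → x ∈ xs → T (x ∈ᵇ xs)
  ∈⇒∈ᵇ {x} {xs} = fromWitness {a? = x ∈? xs}

  ∈ᵇ-++ : ∀ x xs ys → x ∈ᵇ (xs ++ ys) ≡ (x ∈ᵇ xs ∨ x ∈ᵇ ys)
  ∈ᵇ-++ x xs ys with x ∈? xs ++ ys | x ∈? xs | x ∈? ys
  ... | yes _   | yes _    | _        = refl
  ... | yes _   | no _     | yes _    = refl
  ... | yes x∈  | no x∉xs  | no x∉ys  = ⊥-elim ([ x∉xs , x∉ys ] (∈-++⁻ xs x∈))
  ... | no x∉   | yes x∈xs | _        = ⊥-elim (x∉ (∈-++⁺ˡ x∈xs))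
  ... | no x∉   | no _     | yes x∈ys = ⊥-elim (x∉ (∈-++⁺ʳ xs x∈ys))
  ... | no _    | no _     | no _     = refl

  count : (A → Bool) → List A → ℕ
  count p xs = length (filterᵇ p xs)

  count-∈ᵇ-[] : ∀ xs → count (_∈ᵇ []) xs ≡ 0
  count-∈ᵇ-[] []       = refl
  count-∈ᵇ-[] (x ∷ xs) = count-∈ᵇ-[] xs

  count-cong : ∀ {p q} xs → (∀ x → p x ≡ q x) → count p xs ≡ count q xs
  count-cong {p} {q} []       p≗q = refl
  count-cong {p} {q} (x ∷ xs) p≗q with p x | q x | p≗q x
  ... | true  | true  | refl = cong suc (count-cong xs p≗q)
  ... | false | false | refl = count-cong xs p≗q

  count-complement : ∀ p xs → count p xs + count (not ∘ p) xs ≡ length xs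
  count-complement p []       = refl
  count-complement p (x ∷ xs) with p x
  ... | true  = cong suc (count-complement p xs)
  ... | false = trans (+-suc (count p xs) _) (cong suc (count-complement p xs))

  count-mono : ∀ {p q} xs → (∀ x → T (p x) → T (q x)) → count p xs ≤ count q xs
  count-mono {p} {q} []       p⇒q = z≤n
  count-mono {p} {q} (x ∷ xs) p⇒q with p x | q x | p⇒q x
  ... | true  | true  | _   = s≤s (count-mono xs p⇒q)
  ... | true  | false | p⇒q′ = ⊥-elim (p⇒q′ _)
  ... | false | true  | _   = ≤-trans (count-mono xs p⇒q) (n≤1+n _)
  ... | false | false | _   = count-mono xs p⇒q

  count-∈ : ∀ p {x xs} → x ∈ xs → T (p x) → 1 ≤ count p xs
  count-∈ p {xs = y ∷ xs} (here refl) px with p y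
  ... | true  = s≤s z≤n
  count-∈ p {xs = y ∷ xs} (there x∈) px with p y
  ... | true  = s≤s z≤n
  ... | false = count-∈ p x∈ px

  count-witness : ∀ p xs → 1 ≤ count p xs → ∃ λ x → x ∈ xs × T (p x)
  count-witness p (x ∷ xs) 1≤ with p x in px
  ... | true  = x , here refl , subst T (sym px) _
  ... | false with count-witness p xs 1≤
  ...   | y , y∈ , py = y , there y∈ , py

  count-witness₂ : ∀ p xs → Unique xs → 2 ≤ count p xs → ∃₂ λ x y → x ≢ y × (x ∈ xs × T (p x)) × (y ∈ xs × T (p y))
  count-witness₂ p (x ∷ xs) (x∉ ∷ u) 2≤ with p x in px
  ... | true with count-witness p xs (≤-pred 2≤)
  ...   | y , y∈ , py = x , y , All.lookup x∉ y∈ , (here refl , subst T (sym px) _) , (there y∈ , py)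
  count-witness₂ p (x ∷ xs) (x∉ ∷ u) 2≤ | false with count-witness₂ p xs u 2≤
  ...   | y , z , y≢z , (y∈ , py) , (z∈ , pz) = y , z , y≢z , (there y∈ , py) , (there z∈ , pz)

  count-∨-∧ : ∀ p q xs → count (λ x → p x ∨ q x) xs + count (λ x → p x ∧ q x) xs ≡ count p xs + count q xs
  count-∨-∧ p q []       = refl
  count-∨-∧ p q (x ∷ xs) with p x | q x
  ... | true  | true  = cong suc (solve-step (count-∨-∧ p q xs))
    where
    solve-step : ∀ {a b c d} → a + b ≡ c + d → a + suc b ≡ c + suc d
    solve-step {a} {b} {c} {d} e = trans (+-suc a b) (trans (cong suc e) (sym (+-suc c d)))
  ... | true  | false = cong suc (count-∨-∧ p q xs)
  ... | false | true  = trans (cong suc (count-∨-∧ p q xs)) (sym (+-suc (count p xs) (count q xs)))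
  ... | false | false = count-∨-∧ p q xs

  count-∷ : ∀ p x xs → count p (x ∷ xs) ≡ indicator (p x) + count p xs
  count-∷ p x xs with p x
  ... | true  = refl
  ... | false = refl

  -- Inclusion–exclusion, with the terms moved to both sides so that no subtraction occurs.
  count-∨₃ : ∀ p q r xs →
    count (λ x → p x ∨ q x ∨ r x) xs + (count (λ x → p x ∧ q x) xs + count (λ x → p x ∧ r x) xs + count (λ x → q x ∧ r x) xs)
    ≡ count p xs + count q xs + count r xs + count (λ x → p x ∧ q x ∧ r x) xs
  count-∨₃ p q r []       = refl
  count-∨₃ p q r (x ∷ xs)
    rewrite count-∷ (λ x → p x ∨ q x ∨ r x) x xs | count-∷ (λ x → p x ∧ q x) x xs | count-∷ (λ x → p x ∧ r x) x xs
          | count-∷ (λ x → q x ∧ r x) x xs | count-∷ p x xs | count-∷ q x xs | count-∷ r x xs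
          | count-∷ (λ x → p x ∧ q x ∧ r x) x xs
    = add-pointwise (p x) (q x) (r x) (count-∨₃ p q r xs)
    where
    pointwise : ∀ a b c → indicator (a ∨ b ∨ c) + (indicator (a ∧ b) + indicator (a ∧ c) + indicator (b ∧ c))
                         ≡ indicator a + indicator b + indicator c + indicator (a ∧ b ∧ c)
    pointwise true  true  true  = refl
    pointwise true  true  false = refl
    pointwise true  false true  = refl
    pointwise true  false false = refl
    pointwise false true  true  = refl
    pointwise false true  false = refl
    pointwise false false true  = refl
    pointwise false false false = refl
    regroupˡ : ∀ a b c d a′ b′ c′ d′ → (a + a′) + ((b + b′) + (c + c′) + (d + d′)) ≡ (a + (b + c + d)) + (a′ + (b′ + c′ + d′))
    regroupˡ = solve-∀
    regroupʳ : ∀ e f g h e′ f′ g′ h′ → (e + e′) + (f + f′) + (g + g′) + (h + h′) ≡ (e + f + g + h) + (e′ + f′ + g′ + h′)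
    regroupʳ = solve-∀
    add-pointwise : ∀ a b c {a′ b′ c′ d′ e′ f′ g′ h′} → a′ + (b′ + c′ + d′) ≡ e′ + f′ + g′ + h′ →
      (indicator (a ∨ b ∨ c) + a′) + ((indicator (a ∧ b) + b′) + (indicator (a ∧ c) + c′) + (indicator (b ∧ c) + d′))
      ≡ (indicator a + e′) + (indicator b + f′) + (indicator c + g′) + (indicator (a ∧ b ∧ c) + h′)
    add-pointwise a b c {a′} {b′} {c′} {d′} {e′} {f′} {g′} {h′} eq′ =
      trans (regroupˡ (indicator (a ∨ b ∨ c)) (indicator (a ∧ b)) (indicator (a ∧ c)) (indicator (b ∧ c)) a′ b′ c′ d′)
        (trans (cong₂ _+_ (pointwise a b c) eq′)
          (sym (regroupʳ (indicator a) (indicator b) (indicator c) (indicator (a ∧ b ∧ c)) e′ f′ g′ h′)))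

  fresh : List A → List (List A) → List A
  fresh seen []       = []
  fresh seen (L ∷ Ls) = filterᵇ (λ x → not (x ∈ᵇ seen)) L ++ fresh (seen ++ L) Ls

  repeated : List A → List (List A) → ℕ
  repeated seen []       = 0
  repeated seen (L ∷ Ls) = count (_∈ᵇ seen) L + repeated (seen ++ L) Ls

  repeated-[] : ∀ L Ls → repeated [] (L ∷ Ls) ≡ repeated L Ls
  repeated-[] L Ls = cong (_+ repeated L Ls) (count-∈ᵇ-[] L)

  length-fresh : ∀ seen Ls → length (fresh seen Ls) + repeated seen Ls ≡ sum (map length Ls)
  length-fresh seen []       = refl
  length-fresh seen (L ∷ Ls) = begin
    length (new ++ fresh (seen ++ L) Ls) + (count (_∈ᵇ seen) L + repeated (seen ++ L) Ls)
      ≡⟨ cong (_+ (count (_∈ᵇ seen) L + repeated (seen ++ L) Ls)) (length-++ new) ⟩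
    (length new + length (fresh (seen ++ L) Ls)) + (count (_∈ᵇ seen) L + repeated (seen ++ L) Ls)
      ≡⟨ interchange (length new) _ (count (_∈ᵇ seen) L) _ ⟩
    (count (_∈ᵇ seen) L + length new) + (length (fresh (seen ++ L) Ls) + repeated (seen ++ L) Ls)
      ≡⟨ cong₂ _+_ (count-complement (_∈ᵇ seen) L) (length-fresh (seen ++ L) Ls) ⟩
    length L + sum (map length Ls)
      ∎
    where
    open ≡-Reasoning
    new = filterᵇ (λ x → not (x ∈ᵇ seen)) L
    interchange : ∀ a b c d → (a + b) + (c + d) ≡ (c + a) + (b + d)
    interchange = solve-∀

  ∈-fresh⁻ : ∀ seen Ls {x} → x ∈ fresh seen Ls → x ∉ seen × Any (x ∈_) Ls
  ∈-fresh⁻ seen (L ∷ Ls) {x} x∈ with ∈-++⁻ (filterᵇ (λ x → not (x ∈ᵇ seen)) L) x∈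
  ... | inj₁ x∈new with ∈-filter⁻ (λ x → T? (not (x ∈ᵇ seen))) {xs = L} x∈new
  ...   | x∈L , fresh-x = (λ x∈seen → subst (T ∘ not) (Equivalence.to T-≡ (∈⇒∈ᵇ x∈seen)) fresh-x) , here x∈L
  ∈-fresh⁻ seen (L ∷ Ls) {x} x∈ | inj₂ x∈rest with ∈-fresh⁻ (seen ++ L) Ls x∈rest
  ...   | x∉ , x∈Ls = x∉ ∘ ∈-++⁺ˡ , there x∈Ls

  Unique-fresh : ∀ seen Ls → All Unique Ls → Unique (fresh seen Ls)
  Unique-fresh seen []       []          = []
  Unique-fresh seen (L ∷ Ls) (uL ∷ uLs) =
    Unique.++⁺ (Unique.filter⁺ (λ x → T? (not (x ∈ᵇ seen))) uL) (Unique-fresh (seen ++ L) Ls uLs) disjoint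
    where
    disjoint : ∀ {x} → ¬ (x ∈ filterᵇ (λ x → not (x ∈ᵇ seen)) L × x ∈ fresh (seen ++ L) Ls)
    disjoint (x∈new , x∈rest) =
      proj₁ (∈-fresh⁻ (seen ++ L) Ls x∈rest) (∈-++⁺ʳ seen (proj₁ (∈-filter⁻ (λ x → T? (not (x ∈ᵇ seen))) {xs = L} x∈new)))

-- Numbers of common neighbours of the three pairs of a triple that force a common neighbour of
-- the whole triple.
Forced : ℕ → ℕ → ℕ → Set
Forced a b c = (a ≡ 2 × b ≡ 2 × 1 ≤ c) ⊎ (a ≡ 2 × c ≡ 2 × 1 ≤ b) ⊎ (b ≡ 2 × c ≡ 2 × 1 ≤ a)

Forced? : ∀ a b c → Dec (Forced a b c)
Forced? a b c = (a ≟ℕ 2 ×-dec b ≟ℕ 2 ×-dec 1 ≤? c) ⊎-dec (a ≟ℕ 2 ×-dec c ≟ℕ 2 ×-dec 1 ≤? b) ⊎-dec (b ≟ℕ 2 ×-dec c ≟ℕ 2 ×-dec 1 ≤? a)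

forced : ℕ → ℕ → ℕ → ℕ
forced a b c = indicator (does (Forced? a b c))

forced-≤ : ∀ a b c {t} → (Forced a b c → 1 ≤ t) → forced a b c ≤ t
forced-≤ a b c {t} h = indicator-≤ (Forced? a b c)
  where
  indicator-≤ : (d : Dec (Forced a b c)) → indicator (does d) ≤ t
  indicator-≤ (yes abc) = h abc
  indicator-≤ (no _)    = z≤n

AllTwo : ℕ → ℕ → ℕ → ℕ → ℕ → ℕ → Set
AllTwo a b c d e f = a ≡ 2 × b ≡ 2 × c ≡ 2 × d ≡ 2 × e ≡ 2 × f ≡ 2

asFin3 : ∀ {c} → c ≤ 2 → ∃ λ (i : Fin 3) → toℕ i ≡ c
asFin3 c≤2 = fromℕ< (s≤s c≤2) , toℕ-fromℕ< (s≤s c≤2)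

Bounds₃ : ℕ → ℕ → ℕ → Set
Bounds₃ a b c = (a ≡ 2 × b ≡ 2 × c ≡ 2) ⊎ a + b + c ≤ 5

bounds₃ : ∀ (a b c : Fin 3) → Bounds₃ (toℕ a) (toℕ b) (toℕ c)
bounds₃ = toWitness {a? = all? λ a → all? λ b → all? λ c →
  (toℕ a ≟ℕ 2 ×-dec toℕ b ≟ℕ 2 ×-dec toℕ c ≟ℕ 2) ⊎-dec toℕ a + toℕ b + toℕ c ≤? 5} _

repeated₃-≤ : ∀ c₁₂ c₁₃ c₂₃ t X → c₁₂ ≤ 2 → c₁₃ ≤ 2 → c₂₃ ≤ 2 → X + t ≡ c₁₂ + c₁₃ + c₂₃ →
  (c₁₂ ≡ 2 → c₁₃ ≡ 2 → c₂₃ ≡ 2 → 1 ≤ t) → X ≤ 5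
repeated₃-≤ c₁₂ c₁₃ c₂₃ t X l₁₂ l₁₃ l₂₃ e forced with asFin3 l₁₂ | asFin3 l₁₃ | asFin3 l₂₃
... | a , refl | b , refl | c , refl with bounds₃ a b c
...   | inj₁ (a≡2 , b≡2 , c≡2) = +-cancelʳ-≤ 1 X 5 (begin
        X + 1                          ≤⟨ +-monoʳ-≤ X (forced a≡2 b≡2 c≡2) ⟩
        X + t                          ≡⟨ e ⟩
        toℕ a + toℕ b + toℕ c          ≡⟨ cong₂ _+_ (cong₂ _+_ a≡2 b≡2) c≡2 ⟩
        6                              ∎)
  where open ≤-Reasoning
...   | inj₂ ≤5 = ≤-trans (m≤m+n X t) (≤-trans (≤-reflexive e) ≤5)

Bounds₄ : ℕ → ℕ → ℕ → ℕ → ℕ → ℕ → Set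
Bounds₄ a b c d e f =
  a + b + c + d + e + f ≤ 8 + (forced a b c + forced a d e + forced b d f + forced c e f)
  × (AllTwo a b c d e f ⊎ a + b + c + d + e + f ≤ 11)

bounds₄-Fin3 : ∀ (a b c d e f : Fin 3) → Bounds₄ (toℕ a) (toℕ b) (toℕ c) (toℕ d) (toℕ e) (toℕ f)
bounds₄-Fin3 = toWitness {a? = all? λ a → all? λ b → all? λ c → all? λ d → all? λ e → all? λ f →
  decide (toℕ a) (toℕ b) (toℕ c) (toℕ d) (toℕ e) (toℕ f)} _
  where
  decide : ∀ a b c d e f → Dec (Bounds₄ a b c d e f)
  decide a b c d e f =
    a + b + c + d + e + f ≤? 8 + (forced a b c + forced a d e + forced b d f + forced c e f)
    ×-dec ((a ≟ℕ 2 ×-dec b ≟ℕ 2 ×-dec c ≟ℕ 2 ×-dec d ≟ℕ 2 ×-dec e ≟ℕ 2 ×-dec f ≟ℕ 2) ⊎-dec a + b + c + d + e + f ≤? 11)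

bounds₄ : ∀ {a b c d e f} → a ≤ 2 → b ≤ 2 → c ≤ 2 → d ≤ 2 → e ≤ 2 → f ≤ 2 → Bounds₄ a b c d e f
bounds₄ la lb lc ld le lf with asFin3 la | asFin3 lb | asFin3 lc | asFin3 ld | asFin3 le | asFin3 lf
... | a , refl | b , refl | c , refl | d , refl | e , refl | f , refl = bounds₄-Fin3 a b c d e f

repeated₄-core : ∀ S F T q X → X + T ≡ S + q → S ≤ 8 + F → F ≤ T → (1 ≤ q → S ≤ 11 × 1 + q + q + q ≤ T) → X ≤ 8
repeated₄-core S F T zero    X e S≤8+F F≤T _ = +-cancelʳ-≤ T X 8 (begin
  X + T        ≡⟨ trans e (+-identityʳ S) ⟩
  S            ≤⟨ S≤8+F ⟩
  8 + F        ≤⟨ +-monoʳ-≤ 8 F≤T ⟩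
  8 + T        ∎)
  where open ≤-Reasoning
repeated₄-core S F T (suc q) X e _ _ q⇒ with q⇒ (s≤s z≤n)
... | S≤11 , 1+3q≤T = ≤-trans (≤-trans (m≤m+n X q) (m≤m+n (X + q) q)) (+-cancelʳ-≤ 3 (X + q + q) 8 (+-cancelʳ-≤ (suc q) (X + q + q + 3) 11 (begin
  X + q + q + 3 + suc q  ≡⟨ regroup X q ⟩
  X + (1 + suc q + suc q + suc q) ≤⟨ +-monoʳ-≤ X 1+3q≤T ⟩
  X + T                  ≡⟨ e ⟩
  S + suc q              ≤⟨ +-monoˡ-≤ (suc q) S≤11 ⟩
  11 + suc q             ∎)))
  where
  open ≤-Reasoning
  regroup : ∀ x y → x + y + y + 3 + suc y ≡ x + (1 + suc y + suc y + suc y)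
  regroup = solve-∀

-- cᵢⱼ, tᵢⱼₖ and q stand for the numbers of common neighbours of pairs, triples and all four vertices.
repeated₄-≤ : ∀ c₁₂ c₁₃ c₂₃ c₁₄ c₂₄ c₃₄ t₁₂₃ t₁₂₄ t₁₃₄ t₂₃₄ q X →
  c₁₂ ≤ 2 → c₁₃ ≤ 2 → c₂₃ ≤ 2 → c₁₄ ≤ 2 → c₂₄ ≤ 2 → c₃₄ ≤ 2 →
  X + (t₁₂₃ + t₁₂₄ + t₁₃₄ + t₂₃₄) ≡ c₁₂ + c₁₃ + c₂₃ + c₁₄ + c₂₄ + c₃₄ + q →
  forced c₁₂ c₁₃ c₂₃ ≤ t₁₂₃ → forced c₁₂ c₁₄ c₂₄ ≤ t₁₂₄ → forced c₁₃ c₁₄ c₃₄ ≤ t₁₃₄ → forced c₂₃ c₂₄ c₃₄ ≤ t₂₃₄ →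
  (1 ≤ q → 1 ≤ t₁₂₃) → q ≤ t₁₂₄ → q ≤ t₁₃₄ → q ≤ t₂₃₄ → (1 ≤ q → ¬ AllTwo c₁₂ c₁₃ c₂₃ c₁₄ c₂₄ c₃₄) → X ≤ 8
repeated₄-≤ c₁₂ c₁₃ c₂₃ c₁₄ c₂₄ c₃₄ t₁₂₃ t₁₂₄ t₁₃₄ t₂₃₄ q X l₁₂ l₁₃ l₂₃ l₁₄ l₂₄ l₃₄ e
            f₁₂₃ f₁₂₄ f₁₃₄ f₂₃₄ q⇒t₁₂₃ q≤t₁₂₄ q≤t₁₃₄ q≤t₂₃₄ q⇒¬allTwo =
  repeated₄-core _ _ _ q X e S≤8+F (+-mono-≤ (+-mono-≤ (+-mono-≤ f₁₂₃ f₁₂₄) f₁₃₄) f₂₃₄) q⇒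
  where
  S≤8+F = proj₁ (bounds₄ l₁₂ l₁₃ l₂₃ l₁₄ l₂₄ l₃₄)
  q⇒ : 1 ≤ q → _ ≤ 11 × 1 + q + q + q ≤ t₁₂₃ + t₁₂₄ + t₁₃₄ + t₂₃₄
  q⇒ 1≤q with proj₂ (bounds₄ l₁₂ l₁₃ l₂₃ l₁₄ l₂₄ l₃₄)
  ... | inj₁ allTwo = ⊥-elim (q⇒¬allTwo 1≤q allTwo)
  ... | inj₂ S≤11   = S≤11 , +-mono-≤ (+-mono-≤ (+-mono-≤ (q⇒t₁₂₃ 1≤q) q≤t₁₂₄) q≤t₁₃₄) q≤t₂₃₄

module _ {n : ℕ} where

  _≟ⱽ_ : (x y : Vertex {n}) → Dec (x ≡ y)
  _≟ⱽ_ = ≡-dec _≟_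

  open Counting _≟ⱽ_ public

  record Apart (x y : Vertex {n}) : Set where
    field
      permˡ    : IsPerm x
      permʳ    : IsPerm y
      distinct : x ≢ y
      ¬adj     : ¬ Adj x y
      ¬adj′    : ¬ Adj y x

  Apart-sym : ∀ {x y} → Apart x y → Apart y x
  Apart-sym a = record { permˡ = permʳ ; permʳ = permˡ ; distinct = λ e → distinct (sym e) ; ¬adj = ¬adj′ ; ¬adj′ = ¬adj }
    where open Apart a

  commonCount : Vertex {n} → Vertex {n} → ℕ
  commonCount x y = count (_∈ᵇ neighbours x) (neighbours y)

  tripleCount : Vertex {n} → Vertex {n} → Vertex {n} → ℕ
  tripleCount x y z = count (λ r → r ∈ᵇ neighbours x ∧ r ∈ᵇ neighbours y) (neighbours z)

  ∈-commonNeighbours⁻ : ∀ {x y r} → r ∈ filterᵇ (_∈ᵇ neighbours x) (neighbours y) → Common x y r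
  ∈-commonNeighbours⁻ {x} {y} r∈ = ∈ᵇ⇒∈ (proj₂ r∈y×x) , proj₁ r∈y×x
    where r∈y×x = ∈-filter⁻ (λ r → T? (r ∈ᵇ neighbours x)) {xs = neighbours y} r∈

  common-of-count : ∀ {x y} → 1 ≤ commonCount x y → ∃ (Common x y)
  common-of-count {x} {y} 1≤ with count-witness (_∈ᵇ neighbours x) (neighbours y) 1≤
  ... | r , r∈y , r∈ᵇx = r , ∈ᵇ⇒∈ r∈ᵇx , r∈y

  twoCommon : ∀ {x y} → IsPerm y → 2 ≤ commonCount x y → ∃₂ λ r₁ r₂ → r₁ ≢ r₂ × Common x y r₁ × Common x y r₂
  twoCommon {x} {y} py 2≤ with count-witness₂ (_∈ᵇ neighbours x) (neighbours y) (Unique-neighbours py) 2≤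
  ... | r₁ , r₂ , r₁≢r₂ , (r₁∈y , r₁∈ᵇx) , (r₂∈y , r₂∈ᵇx) =
    r₁ , r₂ , r₁≢r₂ , (∈ᵇ⇒∈ r₁∈ᵇx , r₁∈y) , (∈ᵇ⇒∈ r₂∈ᵇx , r₂∈y)

  commonCount-DistanceTwo : ∀ {x y} → Apart x y → 2 ≤ commonCount x y → DistanceTwo x y
  commonCount-DistanceTwo a 2≤ =
    let r₁ , r₂ , r₁≢r₂ , c₁ , c₂ = twoCommon (Apart.permʳ a) 2≤
    in twoCommon⇒DistanceTwo (Apart.permˡ a) (Apart.distinct a) (Apart.¬adj a) c₁ c₂ r₁≢r₂

  commonCount-DistanceTwo′ : ∀ {x y} → Apart x y → 2 ≤ commonCount x y → DistanceTwo y x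
  commonCount-DistanceTwo′ a 2≤ =
    let r₁ , r₂ , r₁≢r₂ , (r₁∈x , r₁∈y) , (r₂∈x , r₂∈y) = twoCommon (Apart.permʳ a) 2≤
    in twoCommon⇒DistanceTwo (Apart.permʳ a) (Apart.distinct (Apart-sym a)) (Apart.¬adj′ a) (r₁∈y , r₁∈x) (r₂∈y , r₂∈x) r₁≢r₂

  DistanceTwo⇒commonCount≤2 : ∀ {x y} → IsPerm x → IsPerm y → DistanceTwo x y → commonCount x y ≤ 2
  DistanceTwo⇒commonCount≤2 {x} {y} px py d@(σ , _) = ≤-trans
    (Unique-⊆⇒length-≤ (Unique.filter⁺ (λ r → T? (r ∈ᵇ neighbours x)) (Unique-neighbours py)) ⊆pairs)
    (≤-reflexive (trans (length-map _ (commonPairs σ)) (length-commonPairs σ)))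
    where
    ⊆pairs : ∀ {r} → r ∈ filterᵇ (_∈ᵇ neighbours x) (neighbours y) → r ∈ map (λ gh → x · genExpr (proj₁ gh)) (commonPairs σ)
    ⊆pairs r∈ =
      let r∈x , r∈y = ∈-commonNeighbours⁻ {x} {y} r∈
          g , lg , r≡xg = ∈-neighbours⁻ {x = x} r∈x
          h , lh , r≡yh = ∈-neighbours⁻ {x = y} r∈y
      in subst (_∈ map (λ gh → x · genExpr (proj₁ gh)) (commonPairs σ)) (sym r≡xg)
           (∈-map⁺ (λ gh → x · genExpr (proj₁ gh)) (common-commonPairs px d lg lh (trans (sym r≡xg) r≡yh)))

  commonCount≤2 : ∀ {x y} → Apart x y → commonCount x y ≤ 2
  commonCount≤2 {x} {y} a = by-cases (2 ≤? commonCount x y)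
    where
    by-cases : Dec (2 ≤ commonCount x y) → commonCount x y ≤ 2
    by-cases (no ≱2)  = ≤-trans (≤-pred (≰⇒> ≱2)) (n≤1+n 1)
    by-cases (yes ≥2) = DistanceTwo⇒commonCount≤2 (Apart.permˡ a) (Apart.permʳ a) (commonCount-DistanceTwo a ≥2)

  tripleCount-∈ : ∀ {x y z r} → r ∈ neighbours x → r ∈ neighbours y → r ∈ neighbours z → 1 ≤ tripleCount x y z
  tripleCount-∈ {x} {y} r∈x r∈y r∈z =
    count-∈ (λ r → r ∈ᵇ neighbours x ∧ r ∈ᵇ neighbours y) r∈z (Equivalence.from T-∧ (∈⇒∈ᵇ r∈x , ∈⇒∈ᵇ r∈y))

  Forced⇒tripleCount : ∀ {x y z} → Apart x y → Apart x z → Apart y z →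
    Forced (commonCount x y) (commonCount x z) (commonCount y z) → 1 ≤ tripleCount x y z
  Forced⇒tripleCount axy axz ayz (inj₁ (xy≡2 , xz≡2 , 1≤yz)) =
    let r , c = common-of-count 1≤yz
        r′ , (r′∈x , r′∈y) , r′∈z = triangle-common (Apart.permˡ axy) (Apart.distinct ayz) (Apart.¬adj ayz)
          (commonCount-DistanceTwo axy (≤-reflexive (sym xy≡2))) (commonCount-DistanceTwo axz (≤-reflexive (sym xz≡2))) c
    in tripleCount-∈ r′∈x r′∈y r′∈z
  Forced⇒tripleCount axy axz ayz (inj₂ (inj₁ (xy≡2 , yz≡2 , 1≤xz))) =
    let r , c = common-of-count 1≤xz
        r′ , (r′∈y , r′∈x) , r′∈z = triangle-common (Apart.permʳ axy) (Apart.distinct axz) (Apart.¬adj axz)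
          (commonCount-DistanceTwo′ axy (≤-reflexive (sym xy≡2))) (commonCount-DistanceTwo ayz (≤-reflexive (sym yz≡2))) c
    in tripleCount-∈ r′∈x r′∈y r′∈z
  Forced⇒tripleCount axy axz ayz (inj₂ (inj₂ (xz≡2 , yz≡2 , 1≤xy))) =
    let r , c = common-of-count 1≤xy
        r′ , (r′∈z , r′∈x) , r′∈y = triangle-common (Apart.permʳ axz) (Apart.distinct axy) (Apart.¬adj axy)
          (commonCount-DistanceTwo′ axz (≤-reflexive (sym xz≡2))) (commonCount-DistanceTwo′ ayz (≤-reflexive (sym yz≡2))) c
    in tripleCount-∈ r′∈x r′∈y r′∈z

  -- A common neighbour of a pair at distance two is reached from the two vertices by generators of
  -- different kinds, and there are only three kinds.
  allTwo⇒noCommon₄ : ∀ {x₁ x₂ x₃ x₄ r} →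
    Apart x₁ x₂ → Apart x₁ x₃ → Apart x₂ x₃ → Apart x₁ x₄ → Apart x₂ x₄ → Apart x₃ x₄ →
    AllTwo (commonCount x₁ x₂) (commonCount x₁ x₃) (commonCount x₂ x₃)
           (commonCount x₁ x₄) (commonCount x₂ x₄) (commonCount x₃ x₄) →
    r ∈ neighbours x₁ → r ∈ neighbours x₂ → r ∈ neighbours x₃ → r ∈ neighbours x₄ → ⊥
  allTwo⇒noCommon₄ {x₁} {x₂} {x₃} {x₄} {r} a₁₂ a₁₃ a₂₃ a₁₄ a₂₄ a₃₄ (e₁₂ , e₁₃ , e₂₃ , e₁₄ , e₂₄ , e₃₄) r∈₁ r∈₂ r∈₃ r∈₄ =
    let g₁ , l₁ , r≡₁ = ∈-neighbours⁻ {x = x₁} r∈₁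
        g₂ , l₂ , r≡₂ = ∈-neighbours⁻ {x = x₂} r∈₂
        g₃ , l₃ , r≡₃ = ∈-neighbours⁻ {x = x₃} r∈₃
        g₄ , l₄ , r≡₄ = ∈-neighbours⁻ {x = x₄} r∈₄
        kinds : ∀ {x y g h} → Apart x y → commonCount x y ≡ 2 → LegalGen g → LegalGen h →
                r ≡ x · genExpr g → r ≡ y · genExpr h → kind g ≢ kind h
        kinds a e lg lh r≡xg r≡yh = DistanceTwo⇒kinds (Apart.permˡ a) (commonCount-DistanceTwo a (≤-reflexive (sym e)))
                                      lg lh (trans (sym r≡xg) r≡yh)
    in kinds-pigeonhole (kind g₁) (kind g₂) (kind g₃) (kind g₄)
         (kinds a₁₂ e₁₂ l₁ l₂ r≡₁ r≡₂) (kinds a₁₃ e₁₃ l₁ l₃ r≡₁ r≡₃) (kinds a₁₄ e₁₄ l₁ l₄ r≡₁ r≡₄)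
         (kinds a₂₃ e₂₃ l₂ l₃ r≡₂ r≡₃) (kinds a₂₄ e₂₄ l₂ l₄ r≡₂ r≡₄) (kinds a₃₄ e₃₄ l₃ l₄ r≡₃ r≡₄)

module _ {n : ℕ} where

  degree : ℕ
  degree = suc (2 * suc n)

  apart : ∀ {S : List (Vertex {n})} {x y} → IsIndependent S → x ∈ S → y ∈ S → x ≢ y → Apart x y
  apart (perms , _ , indep) x∈ y∈ x≢y = record
    { permˡ = All.lookup perms x∈ ; permʳ = All.lookup perms y∈ ; distinct = x≢y
    ; ¬adj = indep x∈ y∈ ; ¬adj′ = indep y∈ x∈ }

  module Neighbourhood (S : List (Vertex {n})) (independent : IsIndependent S) where

    union : List (Vertex {n})
    union = fresh [] (map neighbours S)

    union-InN : All (InN S) union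
    union-InN = All.tabulate λ r∈ → InN-of (map⁻ (proj₂ (∈-fresh⁻ [] (map neighbours S) r∈)))
      where
      InN-of : ∀ {r} → Any (λ x → r ∈ neighbours x) S → InN S r
      InN-of {r} r∈N =
        let x , x∈S , r∈x = find r∈N
            g , _ , r≡xg = ∈-neighbours⁻ {x = x} r∈x
        in subst IsPerm (sym r≡xg) (IsPerm-· (All.lookup (proj₁ independent) x∈S) (genExpr g))
           , (λ r∈S → proj₂ (proj₂ independent) x∈S r∈S (∈neighbours⇒Adj r∈x))
           , x , x∈S , ∈neighbours⇒Adj r∈x

    union-unique : Unique union
    union-unique = Unique-fresh [] (map neighbours S)
      (All.map⁺ (All.map Unique-neighbours (proj₁ independent)))

    length-union : length union + repeated [] (map neighbours S) ≡ length S * degree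
    length-union = trans (length-fresh [] (map neighbours S)) (sum-degrees S)
      where
      sum-degrees : ∀ xs → sum (map length (map neighbours xs)) ≡ length xs * degree
      sum-degrees []       = refl
      sum-degrees (x ∷ xs) = cong₂ _+_ (length-neighbours x) (sum-degrees xs)

    atLeast : ∀ k b → repeated [] (map neighbours S) ≤ b → k + b ≤ length S * degree → AtLeast k (InN S)
    atLeast k b rep≤b k+b≤ = takeAtLeast k union-unique union-InN (+-cancelʳ-≤ _ k (length union) (begin
      k + repeated [] (map neighbours S)   ≤⟨ +-monoʳ-≤ k rep≤b ⟩
      k + b                                ≤⟨ k+b≤ ⟩
      length S * degree                    ≡⟨ sym length-union ⟩
      length union + repeated [] (map neighbours S) ∎))
      where open ≤-Reasoning

  m≡n+o⇒m∸o≡n : ∀ {a} b c → a ≡ b + c → a ∸ c ≡ b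
  m≡n+o⇒m∸o≡n b c refl = m+n∸n≡m b c

  neighbourhood-size₂ : ∀ {x₁ x₂} → IsIndependent (x₁ ∷ x₂ ∷ []) → AtLeast (4 * suc (suc (suc n)) ∸ 8) (InN (x₁ ∷ x₂ ∷ []))
  neighbourhood-size₂ {x₁} {x₂} ind@(_ , ((x₁≢x₂ ∷ []) ∷ _) , _) =
    atLeast _ 2 (≤-trans (≤-reflexive repeated≡) (commonCount≤2 a₁₂)) (≤-reflexive (begin-equality
      4 * suc (suc (suc n)) ∸ 8 + 2  ≡⟨ cong (_+ 2) (m≡n+o⇒m∸o≡n (4 * n + 4) 8 (total n)) ⟩
      4 * n + 4 + 2                  ≡⟨ degrees n ⟩
      2 * degree                     ∎))
    where
    open Neighbourhood (x₁ ∷ x₂ ∷ []) ind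
    open ≤-Reasoning
    a₁₂ : Apart x₁ x₂
    a₁₂ = apart ind (here refl) (there (here refl)) x₁≢x₂
    repeated≡ : repeated [] (map neighbours (x₁ ∷ x₂ ∷ [])) ≡ commonCount x₁ x₂
    repeated≡ = trans (repeated-[] (neighbours x₁) (neighbours x₂ ∷ [])) (+-identityʳ (commonCount x₁ x₂))
    total : ∀ n → 4 * suc (suc (suc n)) ≡ 4 * n + 4 + 8
    total = solve-∀
    degrees : ∀ n → 4 * n + 4 + 2 ≡ 2 * suc (2 * suc n)
    degrees = solve-∀

  neighbourhood-size₃ : ∀ {x₁ x₂ x₃} → IsIndependent (x₁ ∷ x₂ ∷ x₃ ∷ []) → AtLeast (6 * suc (suc (suc n)) ∸ 14) (InN (x₁ ∷ x₂ ∷ x₃ ∷ []))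
  neighbourhood-size₃ {x₁} {x₂} {x₃} ind@(_ , ((x₁≢x₂ ∷ x₁≢x₃ ∷ []) ∷ (x₂≢x₃ ∷ []) ∷ _) , _) =
    atLeast _ 5 repeated≤5 (≤-reflexive (begin-equality
      6 * suc (suc (suc n)) ∸ 14 + 5 ≡⟨ cong (_+ 5) (m≡n+o⇒m∸o≡n (6 * n + 4) 14 (total n)) ⟩
      6 * n + 4 + 5                  ≡⟨ degrees n ⟩
      3 * degree                     ∎))
    where
    open Neighbourhood (x₁ ∷ x₂ ∷ x₃ ∷ []) ind
    open ≤-Reasoning
    a₁₂ : Apart x₁ x₂
    a₁₂ = apart ind (here refl) (there (here refl)) x₁≢x₂
    a₁₃ : Apart x₁ x₃
    a₁₃ = apart ind (here refl) (there (there (here refl))) x₁≢x₃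
    a₂₃ : Apart x₂ x₃
    a₂₃ = apart ind (there (here refl)) (there (there (here refl))) x₂≢x₃
    L₁ = neighbours x₁
    L₂ = neighbours x₂
    L₃ = neighbours x₃
    c₁₂ = commonCount x₁ x₂
    t₁₂₃ = tripleCount x₁ x₂ x₃
    X₃ = count (_∈ᵇ (L₁ ++ L₂)) L₃
    repeated≡ : repeated [] (map neighbours (x₁ ∷ x₂ ∷ x₃ ∷ [])) ≡ c₁₂ + X₃
    repeated≡ = trans (repeated-[] L₁ (L₂ ∷ L₃ ∷ [])) (cong (c₁₂ +_) (+-identityʳ X₃))
    X₃+t≡ : X₃ + t₁₂₃ ≡ commonCount x₁ x₃ + commonCount x₂ x₃
    X₃+t≡ = trans (cong (_+ t₁₂₃) (count-cong L₃ (λ r → ∈ᵇ-++ r L₁ L₂))) (count-∨-∧ (_∈ᵇ L₁) (_∈ᵇ L₂) L₃)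
    repeated≤5 : repeated [] (map neighbours (x₁ ∷ x₂ ∷ x₃ ∷ [])) ≤ 5
    repeated≤5 = subst (_≤ 5) (sym repeated≡) (repeated₃-≤ c₁₂ (commonCount x₁ x₃) (commonCount x₂ x₃) t₁₂₃ (c₁₂ + X₃)
      (commonCount≤2 a₁₂) (commonCount≤2 a₁₃) (commonCount≤2 a₂₃)
      (trans (+-assoc c₁₂ X₃ t₁₂₃) (trans (cong (c₁₂ +_) X₃+t≡) (sym (+-assoc c₁₂ _ _))))
      (λ e₁₂ e₁₃ e₂₃ → Forced⇒tripleCount a₁₂ a₁₃ a₂₃ (inj₁ (e₁₂ , e₁₃ , subst (1 ≤_) (sym e₂₃) (s≤s z≤n)))))
    total : ∀ n → 6 * suc (suc (suc n)) ≡ 6 * n + 4 + 14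
    total = solve-∀
    degrees : ∀ n → 6 * n + 4 + 5 ≡ 3 * suc (2 * suc n)
    degrees = solve-∀

  neighbourhood-size₄ : ∀ {x₁ x₂ x₃ x₄} → IsIndependent (x₁ ∷ x₂ ∷ x₃ ∷ x₄ ∷ []) →
    AtLeast (8 * suc (suc (suc n)) ∸ 20) (InN (x₁ ∷ x₂ ∷ x₃ ∷ x₄ ∷ []))
  neighbourhood-size₄ {x₁} {x₂} {x₃} {x₄} ind@(_ , ((x₁≢x₂ ∷ x₁≢x₃ ∷ x₁≢x₄ ∷ []) ∷ (x₂≢x₃ ∷ x₂≢x₄ ∷ []) ∷ (x₃≢x₄ ∷ []) ∷ _) , _) =
    atLeast _ 8 repeated≤8 (≤-reflexive (begin-equality
      8 * suc (suc (suc n)) ∸ 20 + 8 ≡⟨ cong (_+ 8) (m≡n+o⇒m∸o≡n (8 * n + 4) 20 (total n)) ⟩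
      8 * n + 4 + 8                  ≡⟨ degrees n ⟩
      4 * degree                     ∎))
    where
    open Neighbourhood (x₁ ∷ x₂ ∷ x₃ ∷ x₄ ∷ []) ind
    open ≤-Reasoning
    S = x₁ ∷ x₂ ∷ x₃ ∷ x₄ ∷ []
    ∈₁ : x₁ ∈ S
    ∈₁ = here refl
    ∈₂ : x₂ ∈ S
    ∈₂ = there (here refl)
    ∈₃ : x₃ ∈ S
    ∈₃ = there (there (here refl))
    ∈₄ : x₄ ∈ S
    ∈₄ = there (there (there (here refl)))
    a₁₂ : Apart x₁ x₂
    a₁₂ = apart ind ∈₁ ∈₂ x₁≢x₂
    a₁₃ : Apart x₁ x₃
    a₁₃ = apart ind ∈₁ ∈₃ x₁≢x₃
    a₁₄ : Apart x₁ x₄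
    a₁₄ = apart ind ∈₁ ∈₄ x₁≢x₄
    a₂₃ : Apart x₂ x₃
    a₂₃ = apart ind ∈₂ ∈₃ x₂≢x₃
    a₂₄ : Apart x₂ x₄
    a₂₄ = apart ind ∈₂ ∈₄ x₂≢x₄
    a₃₄ : Apart x₃ x₄
    a₃₄ = apart ind ∈₃ ∈₄ x₃≢x₄
    L₁ = neighbours x₁
    L₂ = neighbours x₂
    L₃ = neighbours x₃
    L₄ = neighbours x₄
    c₁₂ = commonCount x₁ x₂
    c₁₃ = commonCount x₁ x₃
    c₂₃ = commonCount x₂ x₃
    c₁₄ = commonCount x₁ x₄
    c₂₄ = commonCount x₂ x₄
    c₃₄ = commonCount x₃ x₄
    t₁₂₃ = tripleCount x₁ x₂ x₃
    t₁₂₄ = tripleCount x₁ x₂ x₄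
    t₁₃₄ = tripleCount x₁ x₃ x₄
    t₂₃₄ = tripleCount x₂ x₃ x₄
    inAll : Vertex {n} → Bool
    inAll r = r ∈ᵇ L₁ ∧ r ∈ᵇ L₂ ∧ r ∈ᵇ L₃
    q = count inAll L₄
    X₃ = count (_∈ᵇ (L₁ ++ L₂)) L₃
    X₄ = count (_∈ᵇ ((L₁ ++ L₂) ++ L₃)) L₄

    repeated≡ : repeated [] (map neighbours S) ≡ c₁₂ + X₃ + X₄
    repeated≡ = trans (repeated-[] L₁ (L₂ ∷ L₃ ∷ L₄ ∷ []))
      (trans (cong (λ k → c₁₂ + (X₃ + k)) (+-identityʳ X₄)) (sym (+-assoc c₁₂ X₃ X₄)))
    X₃+t≡ : X₃ + t₁₂₃ ≡ c₁₃ + c₂₃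
    X₃+t≡ = trans (cong (_+ t₁₂₃) (count-cong L₃ (λ r → ∈ᵇ-++ r L₁ L₂))) (count-∨-∧ (_∈ᵇ L₁) (_∈ᵇ L₂) L₃)
    X₄+t≡ : X₄ + (t₁₂₄ + t₁₃₄ + t₂₃₄) ≡ c₁₄ + c₂₄ + c₃₄ + q
    X₄+t≡ = trans (cong (_+ (t₁₂₄ + t₁₃₄ + t₂₃₄)) (count-cong L₄ λ r →
      trans (∈ᵇ-++ r (L₁ ++ L₂) L₃) (trans (cong (_∨ r ∈ᵇ L₃) (∈ᵇ-++ r L₁ L₂)) (∨-assoc (r ∈ᵇ L₁) (r ∈ᵇ L₂) (r ∈ᵇ L₃)))))
      (count-∨₃ (_∈ᵇ L₁) (_∈ᵇ L₂) (_∈ᵇ L₃) L₄)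

    inAll⁻ : ∀ r → T (inAll r) → r ∈ L₁ × r ∈ L₂ × r ∈ L₃
    inAll⁻ r inAll-r =
      let r∈₁ , r∈₂₃ = Equivalence.to T-∧ inAll-r
          r∈₂ , r∈₃  = Equivalence.to T-∧ r∈₂₃
      in ∈ᵇ⇒∈ r∈₁ , ∈ᵇ⇒∈ r∈₂ , ∈ᵇ⇒∈ r∈₃
    q≤t : ∀ {i j} → (∀ r → T (inAll r) → r ∈ i × r ∈ j) → q ≤ count (λ r → r ∈ᵇ i ∧ r ∈ᵇ j) L₄
    q≤t sel = count-mono L₄ λ r inAll-r → let r∈i , r∈j = sel r inAll-r in Equivalence.from T-∧ (∈⇒∈ᵇ r∈i , ∈⇒∈ᵇ r∈j)
    q-witness : 1 ≤ q → ∃ λ r → (r ∈ L₁ × r ∈ L₂ × r ∈ L₃) × r ∈ L₄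
    q-witness 1≤q = let r , r∈₄ , inAll-r = count-witness inAll L₄ 1≤q in r , inAll⁻ r inAll-r , r∈₄

    repeated≤8 : repeated [] (map neighbours S) ≤ 8
    repeated≤8 = subst (_≤ 8) (sym repeated≡) (repeated₄-≤ c₁₂ c₁₃ c₂₃ c₁₄ c₂₄ c₃₄ t₁₂₃ t₁₂₄ t₁₃₄ t₂₃₄ q (c₁₂ + X₃ + X₄)
      (commonCount≤2 a₁₂) (commonCount≤2 a₁₃) (commonCount≤2 a₂₃) (commonCount≤2 a₁₄) (commonCount≤2 a₂₄) (commonCount≤2 a₃₄)
      (trans (regroupˡ c₁₂ X₃ X₄ t₁₂₃ t₁₂₄ t₁₃₄ t₂₃₄) (trans (cong₂ (λ a b → c₁₂ + a + b) X₃+t≡ X₄+t≡) (regroupʳ c₁₂ c₁₃ c₂₃ c₁₄ c₂₄ c₃₄ q)))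
      (forced-≤ c₁₂ c₁₃ c₂₃ (Forced⇒tripleCount a₁₂ a₁₃ a₂₃)) (forced-≤ c₁₂ c₁₄ c₂₄ (Forced⇒tripleCount a₁₂ a₁₄ a₂₄))
      (forced-≤ c₁₃ c₁₄ c₃₄ (Forced⇒tripleCount a₁₃ a₁₄ a₃₄)) (forced-≤ c₂₃ c₂₄ c₃₄ (Forced⇒tripleCount a₂₃ a₂₄ a₃₄))
      (λ 1≤q → let _ , (r∈₁ , r∈₂ , r∈₃) , _ = q-witness 1≤q in tripleCount-∈ r∈₁ r∈₂ r∈₃)
      (q≤t λ r inAll-r → let r∈₁ , r∈₂ , _ = inAll⁻ r inAll-r in r∈₁ , r∈₂)
      (q≤t λ r inAll-r → let r∈₁ , _ , r∈₃ = inAll⁻ r inAll-r in r∈₁ , r∈₃)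
      (q≤t λ r inAll-r → let _ , r∈₂ , r∈₃ = inAll⁻ r inAll-r in r∈₂ , r∈₃)
      (λ 1≤q allTwo → let _ , (r∈₁ , r∈₂ , r∈₃) , r∈₄ = q-witness 1≤q
                      in allTwo⇒noCommon₄ a₁₂ a₁₃ a₂₃ a₁₄ a₂₄ a₃₄ allTwo r∈₁ r∈₂ r∈₃ r∈₄))
      where
      regroupˡ : ∀ c X₃ X₄ t₁ t₂ t₃ t₄ → c + X₃ + X₄ + (t₁ + t₂ + t₃ + t₄) ≡ c + (X₃ + t₁) + (X₄ + (t₂ + t₃ + t₄))
      regroupˡ = solve-∀
      regroupʳ : ∀ a b c d e f g → a + (b + c) + (d + e + f + g) ≡ a + b + c + d + e + f + g
      regroupʳ = solve-∀
    total : ∀ n → 8 * suc (suc (suc n)) ≡ 8 * n + 4 + 20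
    total = solve-∀
    degrees : ∀ n → 8 * n + 4 + 8 ≡ 4 * suc (2 * suc n)
    degrees = solve-∀

lemma11 : (n : ℕ) → 4 ≤ n → (S : List (Word n)) → IsIndependent S →
    (length S ≡ 2 → AtLeast (4 * n ∸ 8) (InN S)) ×
    (length S ≡ 3 → AtLeast (6 * n ∸ 14) (InN S)) ×
    (length S ≡ 4 → AtLeast (8 * n ∸ 20) (InN S))
lemma11 (suc (suc (suc n))) _ S ind = pair S ind , triple S ind , quadruple S ind
  where
  pair : ∀ S → IsIndependent S → length S ≡ 2 → AtLeast (4 * suc (suc (suc n)) ∸ 8) (InN S)
  pair (x₁ ∷ x₂ ∷ []) ind refl = neighbourhood-size₂ ind
  triple : ∀ S → IsIndependent S → length S ≡ 3 → AtLeast (6 * suc (suc (suc n)) ∸ 14) (InN S)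
  triple (x₁ ∷ x₂ ∷ x₃ ∷ []) ind refl = neighbourhood-size₃ ind
  quadruple : ∀ S → IsIndependent S → length S ≡ 4 → AtLeast (8 * suc (suc (suc n)) ∸ 20) (InN S)
  quadruple (x₁ ∷ x₂ ∷ x₃ ∷ x₄ ∷ []) ind refl = neighbourhood-size₄ ind
lemma11 zero             ()
lemma11 (suc zero)       (s≤s ())
lemma11 (suc (suc zero)) (s≤s (s≤s ()))
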